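{- Let $H$ be a graph and let $\mathcal X=\{X_y: y\in V(H)\}$ be a bag-minimal $H$-model in a graph $G$. For every $y\in V(H)$: (i) If $y$ has exactly one neighbour $z$ in $H$, then $|X_y|=1$. (ii) If $y$ has exactly two neighbours $z_1,z_2$ in $H$, then $G_y$ is a path (possibly on one vertex) from a unique $X_{z_1}$-attachment vertex to a unique $X_{z_2}$-attachment vertex in $X_y$. (iii) If $y$ has exactly three neighbours $z_1,z_2,z_3$ in $H$, then either $G_y$ is a path between a unique $X_{z_h}$-attachment vertex and a unique $X_{z_i}$-attachment vertex for some distinct $h,i\in\{1,2,3\}$; or $G_y$ consists of a single vertex; or $G_y$ is a tripod or a triangle tripod whose ends are the unique $X_{z_i}$-attachment vertices in $X_y$, $i\in\{1,2,3\}$. In particular, if there is $j\in\{1,2,3\}$ with $|N(X_{z_j})\cap X_y|\ge 2$, then $G_y$ is a path between a unique $X_{z_h}$-attachment vertex and a unique $X_{z_i}$-attachment vertex, where $\{h,i\}=\{1,2,3\}\setminus\{j\}$.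
   Context: All graphs are finite and simple. For a graph $H$, an $H$-model in a graph $G$ is a family $\mathcal X=\{X_y: y\in V(H)\}$ of nonempty, pairwise disjoint vertex subsets of $G$, each inducing a connected subgraph, such that for all distinct $y,z\in V(H)$, $X_y$ and $X_z$ are adjacent (some edge of $G$ joins them) if and only if $yz\in E(H)$. Write $G_y=G[X_y]$. $\mathcal X'$ is contained in $\mathcal X$ if $X'_y\subseteq X_y$ for all $y$; $\mathcal X'$ is smaller than $\mathcal X$ if $\sum_y|X'_y|<\sum_y|X_y|$; $\mathcal X$ is bag-minimal if no smaller $H$-model is contained in it. For $yz\in E(H)$, an $X_z$-attachment vertex in $X_y$ is a vertex of $X_y$ with a neighbour in $X_z$. For a set $S$, $N(S)$ is the set of vertices adjacent to some vertex of $S$. A tripod with ends $v_1,v_2,v_3$ is a tree of maximum degree 3 with exactly one vertex of degree 3 and whose leaves are exactly $v_1,v_2,v_3$. A triangle tripod with ends $v_1,v_2,v_3$ is obtained from three vertex-disjoint paths $P_i$ with end vertices $u_i$ and $v_i$ (possibly $u_i=v_i$), $i=1,2,3$, by adding the edges $u_1u_2,u_1u_3,u_2u_3$. -}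

module Defs where

open import Data.Nat using (ℕ; zero; suc; _≤_)
open import Data.Bool using (Bool; true; false; _∧_)
open import Data.Fin using (Fin; zero; suc; toℕ; fromℕ; inject₁)
open import Data.Fin.Subset using (Subset; _∈_; _∉_; _⊆_; _∩_; ∣_∣; Nonempty)
open import Data.Vec using (tabulate; lookup)
open import Data.List using (List; map; allFin)
open import Data.Bool.ListAction using (any)
open import Data.Nat.ListAction using (sum)
open import Data.Product using (Σ; ∃; ∃-syntax; _×_; _,_)
open import Data.Sum using (_⊎_)
open import Relation.Nullary using (¬_)
open import Relation.Binary.PropositionalEquality using (_≡_; _≢_)
open import Function.Bundles using (_⇔_)
open import Function.Definitions using (Injective)

record Graph : Set where
  field
    n      : ℕ
    adj    : Fin n → Fin n → Bool
    sym    : ∀ u v → adj u v ≡ adj v u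
    irrefl : ∀ v → adj v v ≡ false

open Graph public

V : Graph → Set
V G = Fin (n G)

Adj : (G : Graph) → V G → V G → Set
Adj G u v = adj G u v ≡ true

VSet : Graph → Set
VSet G = Subset (n G)

data Walk (G : Graph) (X : VSet G) : V G → V G → Set where
  here : ∀ {u} → u ∈ X → Walk G X u u
  step : ∀ {u w v} → u ∈ X → Adj G u w → Walk G X w v → Walk G X u v

-- G[X] is connected (X assumed nonempty separately where needed)
Connected : (G : Graph) → VSet G → Set
Connected G X = ∀ u v → u ∈ X → v ∈ X → Walk G X u v

AdjacentSets : (G : Graph) → VSet G → VSet G → Set
AdjacentSets G S T = ∃[ u ] ∃[ v ] (u ∈ S × v ∈ T × Adj G u v)

N : (G : Graph) → VSet G → VSet G
N G S = tabulate (λ v → any (λ u → lookup S u ∧ adj G u v) (allFin (n G)))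

deg : (G : Graph) → VSet G → V G → ℕ
deg G X v = ∣ tabulate (adj G v) ∩ X ∣

record IsModel (G H : Graph) (X : V H → VSet G) : Set where
  field
    nonempty  : ∀ y → Nonempty (X y)
    disjoint  : ∀ y z → y ≢ z → ∀ v → v ∈ X y → v ∉ X z
    connected : ∀ y → Connected G (X y)
    adjacency : ∀ y z → y ≢ z → (AdjacentSets G (X y) (X z) ⇔ Adj H y z)

totalSize : (G H : Graph) → (V H → VSet G) → ℕ
totalSize G H X = sum (map (λ y → ∣ X y ∣) (allFin (n H)))

ContainedIn : (G H : Graph) → (V H → VSet G) → (V H → VSet G) → Set
ContainedIn G H X' X = ∀ y → X' y ⊆ X y

BagMinimal : (G H : Graph) → (V H → VSet G) → Set
BagMinimal G H X =
  IsModel G H X ×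
  (∀ X' → IsModel G H X' → ContainedIn G H X' X →
    ¬ (suc (totalSize G H X') ≤ totalSize G H X))

IsAttachment : (G H : Graph) → (V H → VSet G) → V H → V H → V G → Set
IsAttachment G H X y z v = v ∈ X y × ∃[ w ] (w ∈ X z × Adj G v w)

UniqueAttachment : (G H : Graph) → (V H → VSet G) → V H → V H → V G → Set
UniqueAttachment G H X y z a =
  IsAttachment G H X y z a × (∀ v → IsAttachment G H X y z v → v ≡ a)

IsPath : (G : Graph) → VSet G → V G → V G → Set
IsPath G X a b =
  Σ ℕ λ k → Σ (Fin (suc k) → V G) λ f →
    Injective _≡_ _≡_ f ×
    (∀ v → (v ∈ X ⇔ (∃[ i ] (f i ≡ v)))) ×
    f zero ≡ a × f (fromℕ k) ≡ b ×
    (∀ i j → (Adj G (f i) (f j) ⇔ (toℕ j ≡ suc (toℕ i) ⊎ toℕ i ≡ suc (toℕ j))))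

HasCycle : (G : Graph) → VSet G → Set
HasCycle G X =
  Σ ℕ λ m → Σ (Fin (suc m) → V G) λ f →
    2 ≤ m × Injective _≡_ _≡_ f × (∀ i → f i ∈ X) ×
    (∀ (i : Fin m) → Adj G (f (inject₁ i)) (f (suc i))) ×
    Adj G (f (fromℕ m)) (f zero)

IsTree : (G : Graph) → VSet G → Set
IsTree G X = Nonempty X × Connected G X × ¬ HasCycle G X

IsTripod : (G : Graph) → VSet G → (Fin 3 → V G) → Set
IsTripod G X e =
  IsTree G X ×
  (∀ v → v ∈ X → deg G X v ≤ 3) ×
  (∃[ c ] (c ∈ X × deg G X c ≡ 3 × (∀ v → v ∈ X → deg G X v ≡ 3 → v ≡ c))) ×
  Injective _≡_ _≡_ e ×
  (∀ v → v ∈ X → (deg G X v ≡ 1 ⇔ (∃[ i ] (e i ≡ v)))) ×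
  (∀ i → e i ∈ X)

IsTriangleTripod : (G : Graph) → VSet G → (Fin 3 → V G) → Set
IsTriangleTripod G X e =
  Σ (Fin 3 → VSet G) λ P → Σ (Fin 3 → V G) λ u →
    (∀ v → (v ∈ X ⇔ (∃[ i ] (v ∈ P i)))) ×
    (∀ i j → i ≢ j → ∀ v → v ∈ P i → v ∉ P j) ×
    (∀ i → IsPath G (P i) (u i) (e i)) ×
    (∀ i j → i ≢ j → ∀ a b → a ∈ P i → b ∈ P j →
      (Adj G a b ⇔ (a ≡ u i × b ≡ u j)))

PathBetweenAttachments : (G H : Graph) → (V H → VSet G) → V H → V H → V H → Set
PathBetweenAttachments G H X y z₁ z₂ =
  ∃[ a ] ∃[ b ] (UniqueAttachment G H X y z₁ a × UniqueAttachment G H X y z₂ b ×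
                 IsPath G (X y) a b)

{-# OPTIONS --safe #-}

-- Bag-minimality says that X y is a minimal connected vertex set meeting the attachment sets of
-- all neighbours of y: a connected proper part meeting them all could replace it.  Join two
-- attachment vertices by an induced path P inside X y.  If the third attachment set misses P,
-- walk from it towards P and shortcut to an induced path Q that touches the closed neighbourhood
-- of P only at its last vertex q.  Minimality forces X y = P ∪ Q, and the neighbours of q on P
-- decide the shape: one neighbour at an end of P gives a path, one inner neighbour a tripod, two
-- consecutive ones a triangle tripod, and two non-consecutive ones are impossible, as the vertex
-- between them could be deleted.  An end vertex whose deletion keeps X y connected must be the
-- only attachment vertex of some neighbouring bag, which gives the uniqueness claims.
module Submission where

open import Defs

open import Data.Bool as Bool using (Bool; true; false)
import Data.Bool.Properties as BoolP
open import Data.Empty using (⊥; ⊥-elim)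
open import Data.Fin as Fin using (Fin; toℕ)
import Data.Fin.Properties as FinP
open import Data.Fin.Subset using (Subset; _∈_; _∉_; _∩_; ∣_∣; Nonempty; ⁅_⁆; _-_) renaming (_⊆_ to _⊆ₛ_)
import Data.Fin.Subset.Properties as SubsetP
open import Data.List using (List; []; _∷_; length; map; allFin)
open import Data.List.Membership.Propositional using () renaming (_∈_ to _∈ₗ_)
import Data.List.Membership.Propositional.Properties as ListMembershipP
import Data.List.Relation.Unary.All as All
open import Data.List.Relation.Unary.All using ([]; _∷_)
open import Data.List.Relation.Unary.AllPairs using ([]; _∷_)
import Data.List.Relation.Unary.Any as Any
import Data.List.Relation.Unary.Any.Properties as AnyP
open import Data.List.Relation.Unary.Unique.Propositional using (Unique)
open import Data.Nat as ℕ using (ℕ; zero; suc; pred; _+_; _∸_; _≤_; _<_; z≤n; s≤s; _≤?_)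
open import Data.Nat.ListAction using (sum)
open import Data.Nat.Properties
open import Data.Product using (∃; ∃-syntax; _×_; _,_; proj₁; proj₂)
open import Data.Sum as Sum using (_⊎_; inj₁; inj₂)
open import Data.Vec using (Vec; []; _∷_; here; there; tabulate; lookup)
import Data.Vec.Properties as VecP
open import Data.Vec.Relation.Unary.All using ([]; _∷_)
open import Data.Vec.Relation.Unary.AllPairs using ([]; _∷_)
import Data.Vec.Relation.Unary.Unique.Propositional.Properties as VecUniqueP
open import Function using (_∘_)
open import Function.Bundles using (_⇔_; mk⇔; Equivalence)
open import Function.Definitions using (Injective)
open import Relation.Binary using (tri<; tri≈; tri>)
open import Relation.Binary.PropositionalEquality as ≡ using (_≡_; _≢_; refl; trans; cong; subst; subst₂)
open import Relation.Nullary using (¬_; Dec; yes; no; does)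
import Relation.Nullary.Decidable as Dec
open import Relation.Nullary.Decidable using (_×-dec_; _⊎-dec_)
open import Relation.Unary using (Decidable; _⊆_; _≐_; _∪_; _≬_)

-- Natural numbers

n∸m≡1+[n∸1+m] : ∀ {m n} → m < n → n ∸ m ≡ suc (n ∸ suc m)
n∸m≡1+[n∸1+m] {zero} {suc n} _ = refl
n∸m≡1+[n∸1+m] {suc m} {suc n} (s≤s m<n) = n∸m≡1+[n∸1+m] m<n

≤pred⇒< : ∀ {x k} → 1 ≤ k → x ≤ pred k → x < k
≤pred⇒< {k = suc k} _ x≤k = s≤s x≤k

+-cancelˡ-suc-≤ : ∀ m {x k} → suc (m + x) ≤ m + suc k → x ≤ k
+-cancelˡ-suc-≤ m {x} {k} le = ≤-pred (+-cancelˡ-≤ m (suc x) (suc k) (subst (_≤ m + suc k) (≡.sym (+-suc m x)) le))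

≤⇒≡⊎≡suc⊎2+≤ : ∀ {a b} → a ≤ b → b ≡ a ⊎ b ≡ suc a ⊎ 2 + a ≤ b
≤⇒≡⊎≡suc⊎2+≤ a≤b with m≤n⇒m<n∨m≡n a≤b
... | inj₂ a≡b = inj₁ (≡.sym a≡b)
... | inj₁ a<b with m≤n⇒m<n∨m≡n a<b
...   | inj₂ 1+a≡b = inj₂ (inj₁ (≡.sym 1+a≡b))
...   | inj₁ 2+a≤b = inj₂ (inj₂ 2+a≤b)

m≤n⇒n≤n∸m⇒m≡0 : ∀ {m n} → m ≤ n → n ≤ n ∸ m → m ≡ 0
m≤n⇒n≤n∸m⇒m≡0 {zero} _ _ = refl
m≤n⇒n≤n∸m⇒m≡0 {suc m} m≤n n≤ = ⊥-elim (<-irrefl refl (<-≤-trans (∸-monoʳ-< (s≤s z≤n) m≤n) n≤))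

∃≤ : (ℕ → Set) → ℕ → Set
∃≤ P k = ∃ λ x → x ≤ k × P x

≤suc⇒≤⊎≡ : ∀ {x k} → x ≤ suc k → x ≤ k ⊎ x ≡ suc k
≤suc⇒≤⊎≡ le = Sum.map₁ ≤-pred (m≤n⇒m<n∨m≡n le)

∃≤? : ∀ {P : ℕ → Set} → Decidable P → ∀ k → Dec (∃≤ P k)
∃≤? P? zero = Dec.map′ (λ p → 0 , z≤n , p) (λ { (_ , z≤n , p) → p }) (P? 0)
∃≤? {P} P? (suc k) =
  Dec.map′ Sum.[ (λ p → suc k , ≤-refl , p) , (λ (x , le , p) → x , m≤n⇒m≤1+n le , p) ] split
           (P? (suc k) ⊎-dec ∃≤? P? k)
  where
  split : ∃≤ P (suc k) → P (suc k) ⊎ ∃≤ P k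
  split (x , le , p) with ≤suc⇒≤⊎≡ le
  ... | inj₁ le′ = inj₂ (x , le′ , p)
  ... | inj₂ refl = inj₁ p

greatest≤ : ∀ {P : ℕ → Set} → Decidable P → ∀ k → ∃≤ P k →
            ∃ λ x → x ≤ k × P x × (∀ y → x < y → y ≤ k → ¬ P y)
greatest≤ P? zero (_ , z≤n , p) = 0 , z≤n , p , λ { _ (s≤s _) () }
greatest≤ {P} P? (suc k) (x , le , p) with P? (suc k)
... | yes q = suc k , ≤-refl , q , λ y lt le′ _ → <-irrefl refl (<-≤-trans lt le′)
... | no ¬q with ≤suc⇒≤⊎≡ le
...   | inj₂ refl = ⊥-elim (¬q p)
...   | inj₁ le′ with greatest≤ P? k (x , le′ , p)
...     | (x′ , x′≤k , px′ , above) = x′ , m≤n⇒m≤1+n x′≤k , px′ , above′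
  where
  above′ : ∀ y → x′ < y → y ≤ suc k → ¬ P y
  above′ y lt y≤ with ≤suc⇒≤⊎≡ y≤
  ... | inj₁ y≤k = above y lt y≤k
  ... | inj₂ refl = ¬q

least : ∀ {P : ℕ → Set} → Decidable P → ∀ x → P x → ∃ λ y → P y × (∀ z → z < y → ¬ P z)
least P? x px with P? 0
... | yes p0 = 0 , p0 , λ _ ()
least P? zero px | no ¬p0 = ⊥-elim (¬p0 px)
least {P} P? (suc x) px | no ¬p0 with least (λ z → P? (suc z)) x px
... | (y , py , below) = suc y , py , below′
  where
  below′ : ∀ z → z < suc y → ¬ P z
  below′ zero _ = ¬p0
  below′ (suc z) (s≤s lt) = below z lt

sum-map-mono : ∀ {B : Set} (f g : B → ℕ) xs → (∀ x → f x ≤ g x) → sum (map f xs) ≤ sum (map g xs)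
sum-map-mono f g [] f≤g = z≤n
sum-map-mono f g (x ∷ xs) f≤g = +-mono-≤ (f≤g x) (sum-map-mono f g xs f≤g)

sum-map-< : ∀ {B : Set} (f g : B → ℕ) {xs} → (∀ x → f x ≤ g x) → ∀ {x} → x ∈ₗ xs → f x < g x →
            sum (map f xs) < sum (map g xs)
sum-map-< f g {x ∷ xs} f≤g (Any.here refl) fx<gx = +-mono-<-≤ fx<gx (sum-map-mono f g xs f≤g)
sum-map-< f g {x ∷ xs} f≤g (Any.there x∈xs) fx<gx = +-mono-≤-< (f≤g x) (sum-map-< f g f≤g x∈xs fx<gx)

-- Finite sets

Fin3-cover : ∀ {a b c : Fin 3} → a ≢ b → a ≢ c → b ≢ c → ∀ x → x ≡ a ⊎ x ≡ b ⊎ x ≡ c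
Fin3-cover {a} {b} {c} a≢b a≢c b≢c x with x Fin.≟ a | x Fin.≟ b | x Fin.≟ c
... | yes x≡a | _ | _ = inj₁ x≡a
... | no _ | yes x≡b | _ = inj₂ (inj₁ x≡b)
... | no _ | no _ | yes x≡c = inj₂ (inj₂ x≡c)
... | no x≢a | no x≢b | no x≢c =
  ⊥-elim (<-irrefl refl (FinP.injective⇒≤ {f = lookup four} λ {i} {j} → four-injective i j))
  where
  four : Vec (Fin 3) 4
  four = a ∷ b ∷ c ∷ x ∷ []
  four-injective : ∀ i j → lookup four i ≡ lookup four j → i ≡ j
  four-injective = VecUniqueP.lookup-injective
    ((a≢b ∷ a≢c ∷ (x≢a ∘ ≡.sym) ∷ []) ∷ (b≢c ∷ (x≢b ∘ ≡.sym) ∷ []) ∷ ((x≢c ∘ ≡.sym) ∷ []) ∷ [] ∷ [])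

Fin3-other-two : ∀ {h i h′ i′ j : Fin 3} → h ≢ i → h ≢ j → i ≢ j → h′ ≢ i′ → h′ ≢ j → i′ ≢ j →
                 (h ≡ h′ × i ≡ i′) ⊎ (h ≡ i′ × i ≡ h′)
Fin3-other-two {h} {i} h≢i h≢j i≢j h′≢i′ h′≢j i′≢j
  with Fin3-cover h′≢i′ h′≢j i′≢j h | Fin3-cover h′≢i′ h′≢j i′≢j i
... | inj₁ h≡h′ | inj₂ (inj₁ i≡i′) = inj₁ (h≡h′ , i≡i′)
... | inj₂ (inj₁ h≡i′) | inj₁ i≡h′ = inj₂ (h≡i′ , i≡h′)
... | inj₁ refl | inj₁ refl = ⊥-elim (h≢i refl)
... | inj₂ (inj₁ refl) | inj₂ (inj₁ refl) = ⊥-elim (h≢i refl)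
... | inj₂ (inj₂ refl) | _ = ⊥-elim (h≢j refl)
... | _ | inj₂ (inj₂ refl) = ⊥-elim (i≢j refl)

x∉p-x : ∀ {m} (p : Subset m) x → x ∉ p - x
x∉p-x (_ ∷ p) Fin.zero ()
x∉p-x (_ ∷ p) (Fin.suc x) (there h) = x∉p-x p x h

∣p∣≡1+∣p-x∣ : ∀ {m} {p : Subset m} {x} → x ∈ p → ∣ p ∣ ≡ suc ∣ p - x ∣
∣p∣≡1+∣p-x∣ {p = _ ∷ p} here = cong suc (cong ∣_∣ (≡.sym (SubsetP.p─⊥≡p p)))
∣p∣≡1+∣p-x∣ {p = true ∷ p} (there h) = cong suc (∣p∣≡1+∣p-x∣ h)
∣p∣≡1+∣p-x∣ {p = false ∷ p} (there h) = ∣p∣≡1+∣p-x∣ h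

∣∣≡length : ∀ {m} (S : Subset m) (L : List (Fin m)) → Unique L →
            (∀ {u} → u ∈ S → u ∈ₗ L) → (∀ {u} → u ∈ₗ L → u ∈ S) → ∣ S ∣ ≡ length L
∣∣≡length {m} S [] _ sub _ =
  trans (cong ∣_∣ (SubsetP.Empty-unique λ (_ , u∈S) → ∉[] (sub u∈S))) (SubsetP.∣⊥∣≡0 m)
  where
  ∉[] : ∀ {u} → ¬ u ∈ₗ []
  ∉[] ()
∣∣≡length S (x ∷ L) (x∉L ∷ uniq) sub sup =
  trans (∣p∣≡1+∣p-x∣ (sup (Any.here refl))) (cong suc (∣∣≡length (S - x) L uniq sub′ sup′))
  where
  sub′ : ∀ {u} → u ∈ S - x → u ∈ₗ L
  sub′ h with sub (SubsetP.p─q⊆p S ⁅ x ⁆ h)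
  ... | Any.here refl = ⊥-elim (x∉p-x S x h)
  ... | Any.there u∈L = u∈L
  sup′ : ∀ {u} → u ∈ₗ L → u ∈ S - x
  sup′ u∈L = SubsetP.x∈p∧x≢y⇒x∈p-y (sup (Any.there u∈L)) λ { refl → All.lookup x∉L u∈L refl }

∣p∣≡1 : ∀ {m} {p : Subset m} {a} → a ∈ p → (∀ {u} → u ∈ p → u ≡ a) → ∣ p ∣ ≡ 1
∣p∣≡1 {p = p} a∈p only = ∣∣≡length p (_ ∷ []) ([] ∷ []) (Any.here ∘ only) λ { (Any.here refl) → a∈p }

∈-tabulate⁺ : ∀ {m} {f : Fin m → Bool} {x} → f x ≡ true → x ∈ tabulate f
∈-tabulate⁺ {f = f} {x} fx = VecP.lookup⇒[]= x _ (trans (VecP.lookup∘tabulate f x) fx)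

∈-tabulate⁻ : ∀ {m} {f : Fin m → Bool} {x} → x ∈ tabulate f → f x ≡ true
∈-tabulate⁻ {f = f} {x} h = trans (≡.sym (VecP.lookup∘tabulate f x)) (VecP.[]=⇒lookup h)

toSubset : ∀ {m} {P : Fin m → Set} → Decidable P → Subset m
toSubset P? = tabulate (λ v → does (P? v))

∈-toSubset⁺ : ∀ {m} {P : Fin m → Set} (P? : Decidable P) {v} → P v → v ∈ toSubset P?
∈-toSubset⁺ P? {v} pv = ∈-tabulate⁺ (Dec.dec-true (P? v) pv)

∈-toSubset⁻ : ∀ {m} {P : Fin m → Set} (P? : Decidable P) {v} → v ∈ toSubset P? → P v
∈-toSubset⁻ P? {v} h = witness (P? v) (∈-tabulate⁻ h)
  where
  witness : ∀ {A : Set} (d : Dec A) → does d ≡ true → A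
  witness (yes a) _ = a
  witness (no _) ()

∈N⁻ : ∀ {G : Graph} {S u} → u ∈ N G S → ∃ λ w → w ∈ S × Adj G w u
∈N⁻ {G} {S} {u} u∈N with Any.satisfied (AnyP.any⁻ _ (allFin (n G)) (Equivalence.from BoolP.T-≡ (∈-tabulate⁻ u∈N)))
... | (w , T[Sw∧w~u]) with Equivalence.to BoolP.T-∧ T[Sw∧w~u]
...   | (T[Sw] , T[w~u]) =
  w , VecP.lookup⇒[]= w S (Equivalence.to BoolP.T-≡ T[Sw]) , Equivalence.to BoolP.T-≡ T[w~u]

-- Walks, induced paths and degrees

IsPath-reverse : ∀ {G X a b} → IsPath G X a b → IsPath G X b a
IsPath-reverse {G} {X} (k , f , f-inj , members , f₀≡a , fₖ≡b , adjacency) =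
  k , f ∘ opp , f-inj′ , members′ , fₖ≡b , trans (cong f (FinP.opposite-involutive Fin.zero)) f₀≡a ,
  adjacency′
  where
  opp : Fin (suc k) → Fin (suc k)
  opp = Fin.opposite
  f-inj′ : ∀ {i j} → f (opp i) ≡ f (opp j) → i ≡ j
  f-inj′ {i} {j} e = trans (≡.sym (FinP.opposite-involutive i))
                       (trans (cong opp (f-inj e)) (FinP.opposite-involutive j))
  members′ : ∀ v → (v ∈ X ⇔ ∃ λ i → f (opp i) ≡ v)
  members′ v = mk⇔ (λ v∈X → let (i , e) = Equivalence.to (members v) v∈X
                             in opp i , trans (cong f (FinP.opposite-involutive i)) e)
                   (λ (i , e) → Equivalence.from (members v) (opp i , e))
  shift : ∀ i j → toℕ j ≡ suc (toℕ i) → toℕ (opp i) ≡ suc (toℕ (opp j))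
  shift i j j≡1+i = begin
    toℕ (opp i)           ≡⟨ FinP.opposite-prop i ⟩
    k ∸ toℕ i             ≡⟨ n∸m≡1+[n∸1+m] (subst (_≤ k) j≡1+i (FinP.toℕ≤pred[n] j)) ⟩
    suc (k ∸ suc (toℕ i)) ≡⟨ cong (λ z → suc (k ∸ z)) (≡.sym j≡1+i) ⟩
    suc (k ∸ toℕ j)       ≡⟨ cong suc (≡.sym (FinP.opposite-prop j)) ⟩
    suc (toℕ (opp j))     ∎
    where open ≡.≡-Reasoning
  unshift : ∀ i j → toℕ (opp i) ≡ suc (toℕ (opp j)) → toℕ j ≡ suc (toℕ i)
  unshift i j e = subst₂ (λ x y → toℕ x ≡ suc (toℕ y))
                    (FinP.opposite-involutive j) (FinP.opposite-involutive i) (shift (opp j) (opp i) e)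
  adjacency′ : ∀ i j → Adj G (f (opp i)) (f (opp j)) ⇔ (toℕ j ≡ suc (toℕ i) ⊎ toℕ i ≡ suc (toℕ j))
  adjacency′ i j =
    mk⇔ (Sum.swap ∘ Sum.map (unshift j i) (unshift i j) ∘ Equivalence.to (adjacency (opp i) (opp j)))
        (Equivalence.from (adjacency (opp i) (opp j)) ∘ Sum.swap ∘ Sum.map (shift i j) (shift j i))

module Walks (G : Graph) where

  infix 4 _~_
  _~_ : V G → V G → Set
  _~_ = Adj G

  ~-sym : ∀ {u v} → u ~ v → v ~ u
  ~-sym {u} {v} = trans (Graph.sym G v u)

  ~-irrefl : ∀ {u} → ¬ u ~ u
  ~-irrefl {u} e with trans (≡.sym e) (irrefl G u)
  ... | ()

  _~?_ : ∀ u v → Dec (u ~ v)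
  u ~? v = adj G u v Bool.≟ true

  infixr 5 _∷⟨_⟩_
  data WalkIn (Q : V G → Set) : V G → V G → Set where
    [_]    : ∀ {u} → Q u → WalkIn Q u u
    _∷⟨_⟩_ : ∀ {u w v} → Q u → u ~ w → WalkIn Q w v → WalkIn Q u v

  module _ {Q : V G → Set} where

    headʷ : ∀ {u v} → WalkIn Q u v → Q u
    headʷ [ q ] = q
    headʷ (q ∷⟨ _ ⟩ _) = q

    _++ʷ_ : ∀ {u v w} → WalkIn Q u v → WalkIn Q v w → WalkIn Q u w
    [ _ ] ++ʷ r = r
    (q ∷⟨ e ⟩ r) ++ʷ s = q ∷⟨ e ⟩ (r ++ʷ s)

    reverseʷ : ∀ {u v} → WalkIn Q u v → WalkIn Q v u
    reverseʷ [ q ] = [ q ]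
    reverseʷ (q ∷⟨ e ⟩ r) = reverseʷ r ++ʷ (headʷ r ∷⟨ ~-sym e ⟩ [ q ])

    WalkIn-mono : ∀ {Q′ : V G → Set} {u v} → Q ⊆ Q′ → WalkIn Q u v → WalkIn Q′ u v
    WalkIn-mono f [ q ] = [ f q ]
    WalkIn-mono f (q ∷⟨ e ⟩ r) = f q ∷⟨ e ⟩ WalkIn-mono f r

  Connectedᵖ : (V G → Set) → Set
  Connectedᵖ Q = ∀ {u v} → Q u → Q v → WalkIn Q u v

  Connectedᵖ-resp : ∀ {Q Q′ : V G → Set} → Q ≐ Q′ → Connectedᵖ Q → Connectedᵖ Q′
  Connectedᵖ-resp (Q⊆Q′ , Q′⊆Q) c qu qv = WalkIn-mono Q⊆Q′ (c (Q′⊆Q qu) (Q′⊆Q qv))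

  Connectedᵖ-∪ : ∀ {A B : V G → Set} {a b} → Connectedᵖ A → Connectedᵖ B → A a → B b → a ~ b →
                 Connectedᵖ (A ∪ B)
  Connectedᵖ-∪ {A} {B} {a} {b} cA cB Aa Bb a~b = walk
    where
    across : ∀ {u v} → A u → B v → WalkIn (A ∪ B) u v
    across Au Bv = WalkIn-mono inj₁ (cA Au Aa) ++ʷ (inj₁ Aa ∷⟨ a~b ⟩ WalkIn-mono inj₂ (cB Bb Bv))
    walk : Connectedᵖ (A ∪ B)
    walk (inj₁ Au) (inj₁ Av) = WalkIn-mono inj₁ (cA Au Av)
    walk (inj₂ Bu) (inj₂ Bv) = WalkIn-mono inj₂ (cB Bu Bv)
    walk (inj₁ Au) (inj₂ Bv) = across Au Bv
    walk (inj₂ Bu) (inj₁ Av) = reverseʷ (across Av Bu)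

  Walk⇒WalkIn : ∀ {X u v} → Walk G X u v → WalkIn (_∈ X) u v
  Walk⇒WalkIn (here q) = [ q ]
  Walk⇒WalkIn (step q e r) = q ∷⟨ e ⟩ Walk⇒WalkIn r

  WalkIn⇒Walk : ∀ {X u v} → WalkIn (_∈ X) u v → Walk G X u v
  WalkIn⇒Walk [ q ] = here q
  WalkIn⇒Walk (q ∷⟨ e ⟩ r) = step q e (WalkIn⇒Walk r)

  Connected⇒Connectedᵖ : ∀ {X} → Connected G X → Connectedᵖ (_∈ X)
  Connected⇒Connectedᵖ c Xu Xv = Walk⇒WalkIn (c _ _ Xu Xv)

  Connectedᵖ⇒Connected : ∀ {X} → Connectedᵖ (_∈ X) → Connected G X
  Connectedᵖ⇒Connected c _ _ Xu Xv = WalkIn⇒Walk (c Xu Xv)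

  firstHit : ∀ {Q a b} (S : V G → Set) → Decidable S → WalkIn Q a b → S b →
             ∃ λ c → S c × WalkIn (λ v → Q v × (¬ S v ⊎ v ≡ c)) a c
  firstHit S S? [ q ] Sb = _ , Sb , [ q , inj₂ refl ]
  firstHit S S? (_∷⟨_⟩_ {a} q e r) Sb with S? a
  ... | yes Sa = a , Sa , [ q , inj₂ refl ]
  ... | no ¬Sa with firstHit S S? r Sb
  ...   | (c , Sc , r′) = c , Sc , (q , inj₁ ¬Sa) ∷⟨ e ⟩ r′

  argmax≤ : (h : ℕ → ℕ) → ∀ k → ∃ λ x → x ≤ k × (∀ y → y ≤ k → h y ≤ h x)
  argmax≤ h zero = 0 , z≤n , λ { _ z≤n → ≤-refl }
  argmax≤ h (suc k) with argmax≤ h k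
  ... | (x , x≤k , max) with h x ≤? h (suc k)
  ...   | yes hx≤ = suc k , ≤-refl , below
    where
    below : ∀ y → y ≤ suc k → h y ≤ h (suc k)
    below y y≤ with ≤suc⇒≤⊎≡ y≤
    ... | inj₁ y≤k = ≤-trans (max y y≤k) hx≤
    ... | inj₂ refl = ≤-refl
  ...   | no hx≰ = x , m≤n⇒m≤1+n x≤k , below
    where
    below : ∀ y → y ≤ suc k → h y ≤ h x
    below y y≤ with ≤suc⇒≤⊎≡ y≤
    ... | inj₁ y≤k = max y y≤k
    ... | inj₂ refl = <⇒≤ (≰⇒> hx≰)

  -- On a cycle, a vertex of maximal rank would have two distinct neighbours of no larger rank.
  ranked⇒acyclic : (X : Subset (n G)) (Rank : V G → ℕ → Set) → (∀ {v} → v ∈ X → ∃ (Rank v)) →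
                   (∀ {v r u₁ r₁ u₂ r₂} → u₁ ∈ X → u₂ ∈ X → Rank v r → Rank u₁ r₁ → Rank u₂ r₂ →
                      v ~ u₁ → v ~ u₂ → r₁ ≤ r → r₂ ≤ r → u₁ ≡ u₂) →
                   ¬ HasCycle G X
  ranked⇒acyclic X Rank rank parent (m , f , 2≤m , f-inj , f∈X , f-step , f-close) =
    no-top (argmax≤ r m)
    where
    idx : ℕ → Fin (suc m)
    idx x with x ℕ.<? suc m
    ... | yes x< = Fin.fromℕ< x<
    ... | no _ = Fin.zero
    toℕ-idx : ∀ {x} → x ≤ m → toℕ (idx x) ≡ x
    toℕ-idx {x} x≤m with x ℕ.<? suc m
    ... | yes x< = FinP.toℕ-fromℕ< x<
    ... | no x≮ = ⊥-elim (x≮ (s≤s x≤m))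
    idx-≡ : ∀ {x} (i : Fin (suc m)) → toℕ i ≡ x → x ≤ m → i ≡ idx x
    idx-≡ i i≡x x≤m = FinP.toℕ-injective (trans i≡x (≡.sym (toℕ-idx x≤m)))
    g : ℕ → V G
    g x = f (idx x)
    r : ℕ → ℕ
    r x = proj₁ (rank (f∈X (idx x)))
    g-rank : ∀ x → Rank (g x) (r x)
    g-rank x = proj₂ (rank (f∈X (idx x)))
    g-step : ∀ {x} → x < m → g x ~ g (suc x)
    g-step x<m = subst₂ (λ i j → f i ~ f j)
      (idx-≡ _ (trans (FinP.toℕ-inject₁ _) (FinP.toℕ-fromℕ< x<m)) (<⇒≤ x<m))
      (idx-≡ _ (cong suc (FinP.toℕ-fromℕ< x<m)) x<m)
      (f-step (Fin.fromℕ< x<m))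
    g-close : g m ~ g 0
    g-close = subst₂ (λ i j → f i ~ f j) (idx-≡ _ (FinP.toℕ-fromℕ m) ≤-refl) (idx-≡ _ refl z≤n) f-close
    g-inj : ∀ {x y} → x ≤ m → y ≤ m → g x ≡ g y → x ≡ y
    g-inj x≤m y≤m e = trans (≡.sym (toℕ-idx x≤m)) (trans (cong toℕ (f-inj e)) (toℕ-idx y≤m))
    twoLower : ∀ x {a b} → a ≤ m → b ≤ m → g x ~ g a → g x ~ g b → r a ≤ r x → r b ≤ r x → a ≡ b
    twoLower x {a} {b} a≤m b≤m xa xb ra rb =
      g-inj a≤m b≤m (parent (f∈X (idx a)) (f∈X (idx b)) (g-rank x) (g-rank a) (g-rank b) xa xb ra rb)
    1≤m : 1 ≤ m
    1≤m = ≤-trans (s≤s z≤n) 2≤m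
    no-top : (∃ λ x → x ≤ m × (∀ y → y ≤ m → r y ≤ r x)) → ⊥
    no-top (zero , _ , max) with twoLower 0 1≤m ≤-refl (g-step 1≤m) (~-sym g-close) (max 1 1≤m) (max m ≤-refl)
    ... | 1≡m = <-irrefl 1≡m 2≤m
    no-top (suc x , x<m , max) with suc x ℕ.≟ m
    ... | yes refl with twoLower (suc x) (<⇒≤ x<m) z≤n (~-sym (g-step x<m)) g-close (max x (<⇒≤ x<m)) (max 0 z≤n)
    ...   | refl = <-irrefl refl 2≤m
    no-top (suc x , x<m , max) | no x≢m
      with twoLower (suc x) (<⇒≤ x<m) (≤∧≢⇒< x<m x≢m) (~-sym (g-step x<m)) (g-step (≤∧≢⇒< x<m x≢m))
                    (max x (<⇒≤ x<m)) (max (2 + x) (≤∧≢⇒< x<m x≢m))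
    ... | ()

module InducedPaths (G : Graph) where
  open Walks G

  record InducedPath (k : ℕ) (p : ℕ → V G) : Set where
    field
      edge      : ∀ x → x < k → p x ~ p (suc x)
      distinct  : ∀ x y → 2 + x ≤ y → y ≤ k → p x ≢ p y
      chordless : ∀ x y → 2 + x ≤ y → y ≤ k → ¬ p x ~ p y
  open InducedPath public

  module _ {k p} (P : InducedPath k p) where

    private
      injective< : ∀ {x y} → x < y → y ≤ k → p x ≢ p y
      injective< {x} {y} x<y y≤k e with m≤n⇒m<n∨m≡n x<y
      ... | inj₁ 2+x≤y = distinct P x y 2+x≤y y≤k e
      ... | inj₂ refl = ~-irrefl (subst (_~ p (suc x)) e (edge P x y≤k))

      adjacent< : ∀ {x y} → x < y → y ≤ k → p x ~ p y → y ≡ suc x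
      adjacent< {x} {y} x<y y≤k e with m≤n⇒m<n∨m≡n x<y
      ... | inj₁ 2+x≤y = ⊥-elim (chordless P x y 2+x≤y y≤k e)
      ... | inj₂ y≡1+x = ≡.sym y≡1+x

    injective : ∀ {x y} → x ≤ k → y ≤ k → p x ≡ p y → x ≡ y
    injective {x} {y} x≤k y≤k e with <-cmp x y
    ... | tri≈ _ x≡y _ = x≡y
    ... | tri< x<y _ _ = ⊥-elim (injective< x<y y≤k e)
    ... | tri> _ _ y<x = ⊥-elim (injective< y<x x≤k (≡.sym e))

    consecutive : ∀ {x y} → x ≤ k → y ≤ k → p x ~ p y → y ≡ suc x ⊎ x ≡ suc y
    consecutive {x} {y} x≤k y≤k e with <-cmp x y
    ... | tri≈ _ refl _ = ⊥-elim (~-irrefl e)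
    ... | tri< x<y _ _ = inj₁ (adjacent< x<y y≤k e)
    ... | tri> _ _ y<x = inj₂ (adjacent< y<x x≤k (~-sym e))

    edge⁻ : ∀ {x} → 0 < x → x ≤ k → p x ~ p (pred x)
    edge⁻ {suc x} _ x<k = ~-sym (edge P x x<k)

  OnSegment : (ℕ → V G) → ℕ → ℕ → V G → Set
  OnSegment p lo hi v = ∃ λ x → x ≤ hi × lo ≤ x × p x ≡ v

  onSegment? : ∀ p lo hi → Decidable (OnSegment p lo hi)
  onSegment? p lo hi v = ∃≤? (λ x → (lo ≤? x) ×-dec (p x Fin.≟ v)) hi

  segment-connected : ∀ {k p lo hi} → InducedPath k p → hi ≤ k → Connectedᵖ (OnSegment p lo hi)
  segment-connected {k} {p} {lo} {hi} P hi≤k = walk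
    where
    ascend : ∀ {x} y → lo ≤ x → x ≤ y → y ≤ hi → WalkIn (OnSegment p lo hi) (p x) (p y)
    ascend y lo≤x x≤y y≤hi with m≤n⇒m<n∨m≡n x≤y
    ... | inj₂ refl = [ y , y≤hi , lo≤x , refl ]
    ascend zero lo≤x x≤y y≤hi | inj₁ ()
    ascend (suc y) lo≤x x≤y y≤hi | inj₁ (s≤s x≤y′) =
      ascend y lo≤x x≤y′ y≤hi′ ++ʷ
        ((y , y≤hi′ , lo≤y , refl) ∷⟨ edge P y (≤-trans y≤hi hi≤k) ⟩ [ suc y , y≤hi , m≤n⇒m≤1+n lo≤y , refl ])
      where
      y≤hi′ : y ≤ hi
      y≤hi′ = ≤-trans (n≤1+n y) y≤hi
      lo≤y : lo ≤ y
      lo≤y = ≤-trans lo≤x x≤y′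
    walk : Connectedᵖ (OnSegment p lo hi)
    walk (x , x≤hi , lo≤x , refl) (y , y≤hi , lo≤y , refl) with ≤-total x y
    ... | inj₁ x≤y = ascend y lo≤x x≤y y≤hi
    ... | inj₂ y≤x = reverseʷ (ascend x lo≤y y≤x x≤hi)

  slice : ∀ {k p} s t → InducedPath k p → s + t ≤ k → InducedPath t (λ x → p (s + x))
  slice {k} {p} s t P s+t≤k = record { edge = edge′ ; distinct = distinct′ ; chordless = chordless′ }
    where
    in-range : ∀ {y} → y ≤ t → s + y ≤ k
    in-range y≤t = ≤-trans (+-monoʳ-≤ s y≤t) s+t≤k
    shift : ∀ {x y} → 2 + x ≤ y → 2 + (s + x) ≤ s + y
    shift {x} {y} le = subst (_≤ s + y) (trans (+-suc s (suc x)) (cong suc (+-suc s x))) (+-monoʳ-≤ s le)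
    edge′ : ∀ x → x < t → p (s + x) ~ p (s + suc x)
    edge′ x x<t = subst (λ z → p (s + x) ~ p z) (≡.sym (+-suc s x))
                    (edge P (s + x) (subst (_≤ k) (+-suc s x) (in-range x<t)))
    distinct′ : ∀ x y → 2 + x ≤ y → y ≤ t → p (s + x) ≢ p (s + y)
    distinct′ x y le y≤t = distinct P (s + x) (s + y) (shift le) (in-range y≤t)
    chordless′ : ∀ x y → 2 + x ≤ y → y ≤ t → ¬ p (s + x) ~ p (s + y)
    chordless′ x y le y≤t = chordless P (s + x) (s + y) (shift le) (in-range y≤t)

  reverse : ∀ {k p} → InducedPath k p → InducedPath k (λ x → p (k ∸ x))
  reverse {k} {p} P = record { edge = edge′ ; distinct = distinct′ ; chordless = chordless′ }
    where
    edge′ : ∀ x → x < k → p (k ∸ x) ~ p (k ∸ suc x)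
    edge′ x x<k = subst (λ z → p z ~ p (k ∸ suc x)) (≡.sym (n∸m≡1+[n∸1+m] x<k))
                    (~-sym (edge P (k ∸ suc x) (subst (_≤ k) (n∸m≡1+[n∸1+m] x<k) (m∸n≤m k x))))
    gap : ∀ {x y} → 2 + x ≤ y → y ≤ k → 2 + (k ∸ y) ≤ k ∸ x
    gap {x} le y≤k = <-≤-trans (s≤s (∸-monoʳ-< le y≤k))
                       (∸-monoʳ-< ≤-refl (≤-trans (n≤1+n (suc x)) (≤-trans le y≤k)))
    distinct′ : ∀ x y → 2 + x ≤ y → y ≤ k → p (k ∸ x) ≢ p (k ∸ y)
    distinct′ x y le y≤k e = distinct P (k ∸ y) (k ∸ x) (gap le y≤k) (m∸n≤m k x) (≡.sym e)
    chordless′ : ∀ x y → 2 + x ≤ y → y ≤ k → ¬ p (k ∸ x) ~ p (k ∸ y)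
    chordless′ x y le y≤k e = chordless P (k ∸ y) (k ∸ x) (gap le y≤k) (m∸n≤m k x) (~-sym e)

  single : ∀ p → InducedPath 0 p
  single p = record { edge = λ _ () ; distinct = λ { _ _ () z≤n } ; chordless = λ { _ _ () z≤n } }

  infixr 5 _◅_
  _◅_ : V G → (ℕ → V G) → ℕ → V G
  (u ◅ p) zero = u
  (u ◅ p) (suc x) = p x

  cons : ∀ {k p u} → InducedPath k p → u ~ p 0 → (∀ x → 1 ≤ x → x ≤ k → u ≢ p x × ¬ u ~ p x) →
         InducedPath (suc k) (u ◅ p)
  cons {k} {p} {u} P u~p₀ away = record { edge = edge′ ; distinct = distinct′ ; chordless = chordless′ }
    where
    edge′ : ∀ x → x < suc k → (u ◅ p) x ~ (u ◅ p) (suc x)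
    edge′ zero _ = u~p₀
    edge′ (suc x) (s≤s x<k) = edge P x x<k
    distinct′ : ∀ x y → 2 + x ≤ y → y ≤ suc k → (u ◅ p) x ≢ (u ◅ p) y
    distinct′ zero (suc y) (s≤s le) (s≤s y≤k) = proj₁ (away y le y≤k)
    distinct′ (suc x) (suc y) (s≤s le) (s≤s y≤k) = distinct P x y le y≤k
    chordless′ : ∀ x y → 2 + x ≤ y → y ≤ suc k → ¬ (u ◅ p) x ~ (u ◅ p) y
    chordless′ zero (suc y) (s≤s le) (s≤s y≤k) = proj₂ (away y le y≤k)
    chordless′ (suc x) (suc y) (s≤s le) (s≤s y≤k) = chordless P x y le y≤k

  append : ℕ → (ℕ → V G) → (ℕ → V G) → ℕ → V G
  append zero q p = q 0 ◅ p
  append (suc m) q p = q 0 ◅ append m (λ y → q (suc y)) p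

  append-left : ∀ m q p y → y ≤ m → append m q p y ≡ q y
  append-left zero q p zero _ = refl
  append-left (suc m) q p zero _ = refl
  append-left (suc m) q p (suc y) (s≤s y≤m) = append-left m (λ y → q (suc y)) p y y≤m

  append-right : ∀ m q p x → append m q p (suc (m + x)) ≡ p x
  append-right zero q p x = refl
  append-right (suc m) q p x = append-right m (λ y → q (suc y)) p x

  append-cases : ∀ m q p x → (x ≤ m × append m q p x ≡ q x) ⊎
                             (∃ λ x′ → x ≡ suc (m + x′) × append m q p x ≡ p x′)
  append-cases zero q p zero = inj₁ (z≤n , refl)
  append-cases zero q p (suc x) = inj₂ (x , refl , refl)
  append-cases (suc m) q p zero = inj₁ (z≤n , refl)
  append-cases (suc m) q p (suc x) with append-cases m (λ y → q (suc y)) p x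
  ... | inj₁ (x≤m , e) = inj₁ (s≤s x≤m , e)
  ... | inj₂ (x′ , refl , e) = inj₂ (x′ , refl , e)

  append-induced : ∀ {m k q p} → InducedPath m q → InducedPath k p →
                   (∀ y → y < m → ∀ x → x ≤ k → q y ≢ p x × ¬ q y ~ p x) →
                   (∀ x → x ≤ k → q m ≢ p x) → q m ~ p 0 → (∀ x → 1 ≤ x → x ≤ k → ¬ q m ~ p x) →
                   InducedPath (m + suc k) (append m q p)
  append-induced {zero} Q P apart qₘ∉P qₘ~p₀ qₘ≁P = cons P qₘ~p₀ (λ x 1≤x x≤k → qₘ∉P x x≤k , qₘ≁P x 1≤x x≤k)
  append-induced {suc m} {k} {q} {p} Q P apart qₘ∉P qₘ~p₀ qₘ≁P =
    cons rest (subst (q 0 ~_) (≡.sym (append-left m _ p 0 z≤n)) (edge Q 0 (s≤s z≤n))) away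
    where
    rest : InducedPath (m + suc k) (append m (λ y → q (suc y)) p)
    rest = append-induced (slice 1 m Q ≤-refl) P (λ y y<m → apart (suc y) (s≤s y<m)) qₘ∉P qₘ~p₀ qₘ≁P
    away : ∀ x → 1 ≤ x → x ≤ m + suc k →
           q 0 ≢ append m (λ y → q (suc y)) p x × ¬ q 0 ~ append m (λ y → q (suc y)) p x
    away x 1≤x x≤ with append-cases m (λ y → q (suc y)) p x
    ... | inj₁ (x≤m , e) = (λ q₀≡ → distinct Q 0 (suc x) (s≤s 1≤x) (s≤s x≤m) (trans q₀≡ e)) ,
                           (λ q₀~ → chordless Q 0 (suc x) (s≤s 1≤x) (s≤s x≤m) (subst (q 0 ~_) e q₀~))
    ... | inj₂ (x′ , refl , e) = (λ q₀≡ → proj₁ (apart 0 (s≤s z≤n) x′ x′≤k) (trans q₀≡ e)) ,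
                                 (λ q₀~ → proj₂ (apart 0 (s≤s z≤n) x′ x′≤k) (subst (q 0 ~_) e q₀~))
      where
      x′≤k : x′ ≤ k
      x′≤k = +-cancelˡ-suc-≤ m x≤

  last-off : ∀ {k} {p : ℕ → V G} {m q} → InducedPath m q → (∀ x → x ≤ k → q 0 ≢ p x) →
             (∀ y → y < m → ∀ x → x ≤ k → q y ≢ p x × ¬ q y ~ p x) → ∀ x → x ≤ k → q m ≢ p x
  last-off {m = zero} Q q₀∉P _ = q₀∉P
  last-off {m = suc m} {q} Q _ apart x x≤k e = proj₂ (apart m ≤-refl x x≤k) (subst (q m ~_) e (edge Q m ≤-refl))

  j+x≤k : ∀ {j k x} → j ≤ k → x ≤ k ∸ j → j + x ≤ k
  j+x≤k {j} {k} {x} j≤k x≤ = subst (j + x ≤_) (m+[n∸m]≡n j≤k) (+-monoʳ-≤ j x≤)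

  -- A walk from u to v is shortcut to an induced path: u is glued to the last vertex of the
  -- induced path of the remaining walk that equals or neighbours u.
  walk⇒inducedPath : ∀ {Q u v} → WalkIn Q u v →
                     ∃ λ k → ∃ λ p → InducedPath k p × p 0 ≡ u × p k ≡ v × (∀ x → x ≤ k → Q (p x))
  walk⇒inducedPath [ q ] = 0 , (λ _ → _) , single _ , refl , refl , λ _ _ → q
  walk⇒inducedPath {Q} (_∷⟨_⟩_ {u} q u~w r) with walk⇒inducedPath r
  ... | (k , p , P , p₀≡w , pₖ≡v , p∈Q)
      with greatest≤ meets? k (0 , z≤n , inj₂ (subst (u ~_) (≡.sym p₀≡w) u~w))
    where
    meets? : ∀ x → Dec (u ≡ p x ⊎ u ~ p x)
    meets? x = (u Fin.≟ p x) ⊎-dec (u ~? p x)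
  ... | (j , j≤k , meets , beyond) with u Fin.≟ p j
  ...   | yes u≡pⱼ = k ∸ j , (λ x → p (j + x)) , slice j (k ∸ j) P (j+x≤k j≤k ≤-refl) ,
                     trans (cong p (+-identityʳ j)) (≡.sym u≡pⱼ) ,
                     trans (cong p (m+[n∸m]≡n j≤k)) pₖ≡v ,
                     (λ x x≤ → p∈Q (j + x) (j+x≤k j≤k x≤))
  ...   | no u≢pⱼ = suc (k ∸ j) , u ◅ (λ x → p (j + x)) ,
                    cons (slice j (k ∸ j) P (j+x≤k j≤k ≤-refl)) u~pⱼ away ,
                    refl , trans (cong p (m+[n∸m]≡n j≤k)) pₖ≡v , ◅∈Q
    where
    u~pⱼ : u ~ p (j + 0)
    u~pⱼ = subst (λ z → u ~ p z) (≡.sym (+-identityʳ j)) (Sum.[ (λ e → ⊥-elim (u≢pⱼ e)) , (λ a → a) ] meets)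
    away : ∀ x → 1 ≤ x → x ≤ k ∸ j → u ≢ p (j + x) × ¬ u ~ p (j + x)
    away x 1≤x x≤ = (λ e → beyond (j + x) j<j+x (j+x≤k j≤k x≤) (inj₁ e)) ,
                    (λ a → beyond (j + x) j<j+x (j+x≤k j≤k x≤) (inj₂ a))
      where
      j<j+x : j < j + x
      j<j+x = subst (_≤ j + x) (+-comm j 1) (+-monoʳ-≤ j 1≤x)
    ◅∈Q : ∀ x → x ≤ suc (k ∸ j) → Q ((u ◅ (λ x → p (j + x))) x)
    ◅∈Q zero _ = q
    ◅∈Q (suc x) (s≤s x≤) = p∈Q (j + x) (j+x≤k j≤k x≤)

  segment⇒IsPath : ∀ {k p lo hi} (S : Subset (n G)) → InducedPath k p → lo ≤ hi → hi ≤ k →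
                   (_∈ S) ≐ OnSegment p lo hi → IsPath G S (p lo) (p hi)
  segment⇒IsPath {k} {p} {lo} {hi} S P lo≤hi hi≤k (S⊆seg , seg⊆S) =
    subst₂ (IsPath G S) (cong p (+-identityʳ lo)) (cong p (m+[n∸m]≡n lo≤hi))
      (whole (slice lo (hi ∸ lo) P (subst (_≤ k) (≡.sym (m+[n∸m]≡n lo≤hi)) hi≤k)) S⊆seg′ seg′⊆S)
    where
    S⊆seg′ : (_∈ S) ⊆ OnSegment (λ x → p (lo + x)) 0 (hi ∸ lo)
    S⊆seg′ v∈S with S⊆seg v∈S
    ... | (x , x≤hi , lo≤x , e) = x ∸ lo , ∸-monoˡ-≤ lo x≤hi , z≤n , trans (cong p (m+[n∸m]≡n lo≤x)) e
    seg′⊆S : OnSegment (λ x → p (lo + x)) 0 (hi ∸ lo) ⊆ (_∈ S)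
    seg′⊆S (x , x≤ , _ , e) = seg⊆S (lo + x , j+x≤k lo≤hi x≤ , m≤m+n lo x , e)
    whole : ∀ {t q} → InducedPath t q → (_∈ S) ⊆ OnSegment q 0 t → OnSegment q 0 t ⊆ (_∈ S) →
            IsPath G S (q 0) (q t)
    whole {t} {q} Q S⊆ ⊆S = t , f , f-inj , members , refl , cong q (FinP.toℕ-fromℕ t) , adjacency
      where
      f : Fin (suc t) → V G
      f i = q (toℕ i)
      bound : ∀ (i : Fin (suc t)) → toℕ i ≤ t
      bound = FinP.toℕ≤pred[n]
      f-inj : ∀ {i j} → f i ≡ f j → i ≡ j
      f-inj {i} {j} e = FinP.toℕ-injective (injective Q (bound i) (bound j) e)
      members : ∀ v → (v ∈ S ⇔ ∃ λ i → f i ≡ v)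
      members v = mk⇔ (λ v∈S → index (S⊆ v∈S)) (λ { (i , refl) → ⊆S (toℕ i , bound i , z≤n , refl) })
        where
        index : OnSegment q 0 t v → ∃ λ i → f i ≡ v
        index (x , x≤t , _ , e) = Fin.fromℕ< (s≤s x≤t) , trans (cong q (FinP.toℕ-fromℕ< (s≤s x≤t))) e
      adjacency : ∀ i j → (f i ~ f j) ⇔ (toℕ j ≡ suc (toℕ i) ⊎ toℕ i ≡ suc (toℕ j))
      adjacency i j = mk⇔ (consecutive Q (bound i) (bound j)) edge′
        where
        edge′ : toℕ j ≡ suc (toℕ i) ⊎ toℕ i ≡ suc (toℕ j) → f i ~ f j
        edge′ (inj₁ e) = subst (λ z → f i ~ q z) (≡.sym e) (edge Q (toℕ i) (subst (_≤ t) e (bound j)))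
        edge′ (inj₂ e) = ~-sym (subst (λ z → f j ~ q z) (≡.sym e) (edge Q (toℕ j) (subst (_≤ t) e (bound i))))

module Degrees (G : Graph) (X : Subset (n G)) where
  open Walks G

  private
    neighbour⁺ : ∀ {v u} → u ∈ X → v ~ u → u ∈ tabulate (adj G v) ∩ X
    neighbour⁺ u∈X v~u = SubsetP.x∈p∩q⁺ (∈-tabulate⁺ v~u , u∈X)

    neighbour⁻ : ∀ {v u} → u ∈ tabulate (adj G v) ∩ X → u ∈ X × v ~ u
    neighbour⁻ h with SubsetP.x∈p∩q⁻ _ X h
    ... | (u∈N , u∈X) = u∈X , ∈-tabulate⁻ u∈N

  deg≡length : ∀ {v} L → Unique L → (∀ {u} → u ∈ X → v ~ u → u ∈ₗ L) →
               (∀ {u} → u ∈ₗ L → u ∈ X × v ~ u) → deg G X v ≡ length L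
  deg≡length L uniq listed valid =
    ∣∣≡length _ L uniq (λ h → let (u∈X , v~u) = neighbour⁻ h in listed u∈X v~u)
                       (λ u∈L → let (u∈X , v~u) = valid u∈L in neighbour⁺ u∈X v~u)

  deg≡1 : ∀ {v a} → a ∈ X → v ~ a → (∀ {u} → u ∈ X → v ~ u → u ≡ a) → deg G X v ≡ 1
  deg≡1 a∈X v~a only = deg≡length (_ ∷ []) ([] ∷ []) (λ u∈X v~u → Any.here (only u∈X v~u))
                         λ { (Any.here refl) → a∈X , v~a }

  deg≡2 : ∀ {v a b} → a ≢ b → a ∈ X → b ∈ X → v ~ a → v ~ b →
          (∀ {u} → u ∈ X → v ~ u → u ≡ a ⊎ u ≡ b) → deg G X v ≡ 2
  deg≡2 {v} {a} {b} a≢b a∈X b∈X v~a v~b only =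
    deg≡length (a ∷ b ∷ []) ((a≢b ∷ []) ∷ [] ∷ []) listed valid
    where
    listed : ∀ {u} → u ∈ X → v ~ u → u ∈ₗ (a ∷ b ∷ [])
    listed u∈X v~u with only u∈X v~u
    ... | inj₁ u≡a = Any.here u≡a
    ... | inj₂ u≡b = Any.there (Any.here u≡b)
    valid : ∀ {u} → u ∈ₗ (a ∷ b ∷ []) → u ∈ X × v ~ u
    valid (Any.here refl) = a∈X , v~a
    valid (Any.there (Any.here refl)) = b∈X , v~b

  deg≡3 : ∀ {v a b c} → a ≢ b → a ≢ c → b ≢ c → a ∈ X → b ∈ X → c ∈ X → v ~ a → v ~ b → v ~ c →
          (∀ {u} → u ∈ X → v ~ u → u ≡ a ⊎ u ≡ b ⊎ u ≡ c) → deg G X v ≡ 3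
  deg≡3 {v} {a} {b} {c} a≢b a≢c b≢c a∈X b∈X c∈X v~a v~b v~c only =
    deg≡length (a ∷ b ∷ c ∷ []) ((a≢b ∷ a≢c ∷ []) ∷ (b≢c ∷ []) ∷ [] ∷ []) listed valid
    where
    listed : ∀ {u} → u ∈ X → v ~ u → u ∈ₗ (a ∷ b ∷ c ∷ [])
    listed u∈X v~u with only u∈X v~u
    ... | inj₁ u≡a = Any.here u≡a
    ... | inj₂ (inj₁ u≡b) = Any.there (Any.here u≡b)
    ... | inj₂ (inj₂ u≡c) = Any.there (Any.there (Any.here u≡c))
    valid : ∀ {u} → u ∈ₗ (a ∷ b ∷ c ∷ []) → u ∈ X × v ~ u
    valid (Any.here refl) = a∈X , v~a
    valid (Any.there (Any.here refl)) = b∈X , v~b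
    valid (Any.there (Any.there (Any.here refl))) = c∈X , v~c

-- Connected sets meeting given terminals minimally

record MinimalConnector (G : Graph) (X : Subset (n G)) {d : ℕ} (A : Fin d → V G → Set) : Set₁ where
  field
    attaches? : ∀ t → Decidable (A t)
    connected : Walks.Connectedᵖ G (_∈ X)
    meets     : ∀ t → (_∈ X) ≬ A t
    minimal   : ∀ {Y} → Decidable Y → Y ⊆ (_∈ X) → Walks.Connectedᵖ G Y → (∀ t → Y ≬ A t) → (_∈ X) ⊆ Y

module Connector {G : Graph} {X : Subset (n G)} {d} {A : Fin d → V G → Set} (C : MinimalConnector G X A) where
  open MinimalConnector C public
  open Walks G
  open InducedPaths G

  fills : ∀ {Y} → Decidable Y → Y ⊆ (_∈ X) → Connectedᵖ Y → (∀ t → Y ≬ A t) → (_∈ X) ≐ Y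
  fills Y? Y⊆X cY meetsY = minimal Y? Y⊆X cY meetsY , Y⊆X

  SoleAttachment : Fin d → V G → Set
  SoleAttachment t a = (a ∈ X × A t a) × (∀ v → v ∈ X × A t v → v ≡ a)

  Without : V G → V G → Set
  Without v u = u ∈ X × u ≢ v

  without? : ∀ v → Decidable (Without v)
  without? v u = (u SubsetP.∈? X) ×-dec Dec.¬? (u Fin.≟ v)

  sole-if-unmet : ∀ {v t} → ¬ Without v ≬ A t → SoleAttachment t v
  sole-if-unmet {v} {t} unmet = sole (meets t)
    where
    only : ∀ u → u ∈ X × A t u → u ≡ v
    only u (u∈X , Au) with u Fin.≟ v
    ... | yes u≡v = u≡v
    ... | no u≢v = ⊥-elim (unmet (u , (u∈X , u≢v) , Au))
    sole : (_∈ X) ≬ A t → SoleAttachment t v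
    sole (a , attached) = subst (λ a → a ∈ X × A t a) (only a attached) attached , only

  nonCut⇒sole-for : ∀ {v} t₀ → v ∈ X → Connectedᵖ (Without v) → (∀ t → t ≢ t₀ → Without v ≬ A t) →
                    SoleAttachment t₀ v
  nonCut⇒sole-for {v} t₀ v∈X connected-v others = sole-if-unmet unmet
    where
    unmet : ¬ Without v ≬ A t₀
    unmet met₀ = proj₂ (minimal (without? v) proj₁ connected-v met v∈X) refl
      where
      met : ∀ t → Without v ≬ A t
      met t with t Fin.≟ t₀
      ... | yes refl = met₀
      ... | no t≢t₀ = others t t≢t₀

  nonCut⇒sole : ∀ {v} → v ∈ X → Connectedᵖ (Without v) → ∃ λ t → SoleAttachment t v
  nonCut⇒sole {v} v∈X connected-v with FinP.all? (λ t → FinP.any? (λ u → without? v u ×-dec attaches? t u))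
  ... | yes met = ⊥-elim (proj₂ (minimal (without? v) proj₁ connected-v met v∈X) refl)
  ... | no ¬met with FinP.¬∀⟶∃¬ d _ (λ t → FinP.any? (λ u → without? v u ×-dec attaches? t u)) ¬met
  ...   | (t , unmet) = t , sole-if-unmet unmet

  module Along {k p} (P : InducedPath k p) (X≐P : (_∈ X) ≐ OnSegment p 0 k) where

    p∈X : ∀ x → x ≤ k → p x ∈ X
    p∈X x x≤k = proj₂ X≐P (x , x≤k , z≤n , refl)

    isPath : IsPath G X (p 0) (p k)
    isPath = segment⇒IsPath X P z≤n ≤-refl X≐P

    trivial : k ≡ 0 → ∀ {u} → u ∈ X → u ≡ p 0
    trivial refl u∈X with proj₁ X≐P u∈X
    ... | (zero , _ , _ , e) = ≡.sym e

    without-first : Connectedᵖ (Without (p 0))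
    without-first = Connectedᵖ-resp (seg⊆ , ⊆seg) (segment-connected {lo = 1} P ≤-refl)
      where
      seg⊆ : OnSegment p 1 k ⊆ Without (p 0)
      seg⊆ (x , x≤k , 1≤x , refl) = p∈X x x≤k , λ e → <-irrefl (≡.sym (injective P x≤k z≤n e)) 1≤x
      ⊆seg : Without (p 0) ⊆ OnSegment p 1 k
      ⊆seg (u∈X , u≢p₀) with proj₁ X≐P u∈X
      ... | (zero , _ , _ , e) = ⊥-elim (u≢p₀ (≡.sym e))
      ... | (suc x , x≤k , _ , e) = suc x , x≤k , s≤s z≤n , e

    without-last : 1 ≤ k → Connectedᵖ (Without (p k))
    without-last 1≤k = Connectedᵖ-resp (seg⊆ , ⊆seg) (segment-connected {lo = 0} P pred[n]≤n)
      where
      seg⊆ : OnSegment p 0 (pred k) ⊆ Without (p k)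
      seg⊆ (x , x≤ , _ , refl) = p∈X x (≤pred⇒≤ x≤) ,
                                 λ e → <-irrefl (injective P (≤pred⇒≤ x≤) ≤-refl e) (≤pred⇒< 1≤k x≤)
      ⊆seg : Without (p k) ⊆ OnSegment p 0 (pred k)
      ⊆seg (u∈X , u≢pₖ) with proj₁ X≐P u∈X
      ... | (x , x≤k , _ , refl) = x , <⇒≤pred (≤∧≢⇒< x≤k (λ x≡k → u≢pₖ (cong p x≡k))) , z≤n , refl

    sole-ends : 1 ≤ k → ∃ λ t₀ → ∃ λ t₁ → t₀ ≢ t₁ × SoleAttachment t₀ (p 0) × SoleAttachment t₁ (p k)
    sole-ends 1≤k with nonCut⇒sole (p∈X 0 z≤n) without-first | nonCut⇒sole (p∈X k ≤-refl) (without-last 1≤k)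
    ... | (t₀ , sole₀) | (t₁ , sole₁) = t₀ , t₁ , t₀≢t₁ , sole₀ , sole₁
      where
      t₀≢t₁ : t₀ ≢ t₁
      t₀≢t₁ refl = <-irrefl (injective P z≤n ≤-refl (proj₂ sole₁ (p 0) (proj₁ sole₀))) 1≤k

    ∣X∣≡1 : k ≡ 0 → ∣ X ∣ ≡ 1
    ∣X∣≡1 k≡0 = ∣p∣≡1 (p∈X 0 z≤n) (trivial k≡0)

    all-sole : k ≡ 0 → ∀ t → SoleAttachment t (p 0)
    all-sole k≡0 t = sole-if-unmet λ (u , (u∈X , u≢p₀) , _) → u≢p₀ (trivial k≡0 u∈X)

  one-terminal : ∀ t₀ → (∀ t → t ≡ t₀) → ∣ X ∣ ≡ 1
  one-terminal t₀ only = singleton (meets t₀)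
    where
    singleton : (_∈ X) ≬ A t₀ → ∣ X ∣ ≡ 1
    singleton (a , a∈X , Aa) =
      ∣p∣≡1 a∈X (minimal (Fin._≟ a) (λ { refl → a∈X }) (λ { refl refl → [ refl ] })
                         (λ t → a , refl , subst (λ t → A t a) (≡.sym (only t)) Aa))

  PathBetween : Fin d → Fin d → Set
  PathBetween h i = ∃ λ a → ∃ λ b → SoleAttachment h a × SoleAttachment i b × IsPath G X a b

  segment-fills : ∀ {k p} → InducedPath k p → (∀ x → x ≤ k → p x ∈ X) → (∀ t → OnSegment p 0 k ≬ A t) →
                  (_∈ X) ≐ OnSegment p 0 k
  segment-fills P p∈X met =
    fills (onSegment? _ 0 _) (λ (x , x≤k , _ , e) → subst (_∈ X) e (p∈X x x≤k)) (segment-connected P ≤-refl) met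

  induced-between : ∀ t₀ t₁ → ∃ λ k → ∃ λ p → InducedPath k p × (∀ x → x ≤ k → p x ∈ X) × A t₀ (p 0) × A t₁ (p k)
  induced-between t₀ t₁ with meets t₀ | meets t₁
  ... | (a , a∈X , Aa) | (b , b∈X , Ab) with walk⇒inducedPath (connected a∈X b∈X)
  ...   | (k , p , P , p₀≡a , pₖ≡b , p∈X) =
    k , p , P , p∈X , subst (A t₀) (≡.sym p₀≡a) Aa , subst (A t₁) (≡.sym pₖ≡b) Ab

  two-terminals : ∀ t₀ t₁ → (∀ t → t ≡ t₀ ⊎ t ≡ t₁) → PathBetween t₀ t₁
  two-terminals t₀ t₁ cover with induced-between t₀ t₁
  ... | (k , p , P , p∈X , A₀ , A₁) = shape (k ℕ.≟ 0)
    where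
    met : ∀ t → OnSegment p 0 k ≬ A t
    met t with cover t
    ... | inj₁ refl = p 0 , (0 , z≤n , z≤n , refl) , A₀
    ... | inj₂ refl = p k , (k , ≤-refl , z≤n , refl) , A₁
    open Along P (segment-fills P p∈X met)
    shape : Dec (k ≡ 0) → PathBetween t₀ t₁
    shape (yes k≡0) =
      p 0 , p k , all-sole k≡0 t₀ , subst (SoleAttachment t₁) (cong p (≡.sym k≡0)) (all-sole k≡0 t₁) , isPath
    shape (no k≢0) with sole-ends (n≢0⇒n>0 k≢0)
    ... | (u₀ , u₁ , u₀≢u₁ , sole₀ , sole₁) with cover u₀ | cover u₁
    ...   | inj₁ refl | inj₂ refl = p 0 , p k , sole₀ , sole₁ , isPath
    ...   | inj₂ refl | inj₁ refl = p k , p 0 , sole₁ , sole₀ , IsPath-reverse {G} isPath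
    ...   | inj₁ refl | inj₁ refl = ⊥-elim (u₀≢u₁ refl)
    ...   | inj₂ refl | inj₂ refl = ⊥-elim (u₀≢u₁ refl)

pattern 0F = Fin.zero
pattern 1F = Fin.suc Fin.zero
pattern 2F = Fin.suc (Fin.suc Fin.zero)

module ThreeTerminals {G : Graph} {X : Subset (n G)} {A : Fin 3 → V G → Set} (C : MinimalConnector G X A) where
  open Walks G
  open InducedPaths G
  open Connector C
  open Degrees G X

  Shape : Set
  Shape = (∃ λ h → ∃ λ i → h ≢ i × PathBetween h i) ⊎ ∣ X ∣ ≡ 1 ⊎
          ∃ λ e → (∀ i → SoleAttachment i (e i)) × (IsTripod G X e ⊎ IsTriangleTripod G X e)

  along⇒shape : ∀ {k p} → InducedPath k p → (_∈ X) ≐ OnSegment p 0 k → Shape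
  along⇒shape {k} {p} P X≐P = shape (k ℕ.≟ 0)
    where
    open Along P X≐P
    shape : Dec (k ≡ 0) → Shape
    shape (yes k≡0) = inj₂ (inj₁ (∣X∣≡1 k≡0))
    shape (no k≢0) with sole-ends (n≢0⇒n>0 k≢0)
    ... | (h , i , h≢i , sole-h , sole-i) = inj₁ (h , i , h≢i , p 0 , p k , sole-h , sole-i , isPath)

  joined⇒shape : ∀ {k p m q} → InducedPath k p → InducedPath m q →
                 (∀ x → x ≤ k → p x ∈ X) → (∀ y → y ≤ m → q y ∈ X) →
                 (∀ y → y < m → ∀ x → x ≤ k → q y ≢ p x × ¬ q y ~ p x) → (∀ x → x ≤ k → q m ≢ p x) →
                 q m ~ p 0 → (∀ x → x ≤ k → q m ~ p x → x ≡ 0) →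
                 (_∈ X) ⊆ (OnSegment p 0 k ∪ OnSegment q 0 m) → Shape
  joined⇒shape {k} {p} {m} {q} P Q p∈X q∈X apart qₘ∉P qₘ~p₀ only-p₀ X⊆P∪Q =
    along⇒shape (append-induced Q P apart qₘ∉P qₘ~p₀ (λ x 1≤x x≤k a → <-irrefl (≡.sym (only-p₀ x x≤k a)) 1≤x))
                (X⊆ , ⊆X)
    where
    X⊆ : (_∈ X) ⊆ OnSegment (append m q p) 0 (m + suc k)
    X⊆ v∈X with X⊆P∪Q v∈X
    ... | inj₁ (x , x≤k , _ , e) =
      suc (m + x) , subst (suc (m + x) ≤_) (≡.sym (+-suc m k)) (s≤s (+-monoʳ-≤ m x≤k)) , z≤n ,
      trans (append-right m q p x) e
    ... | inj₂ (y , y≤m , _ , e) = y , ≤-trans y≤m (m≤m+n m (suc k)) , z≤n , trans (append-left m q p y y≤m) e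
    ⊆X : OnSegment (append m q p) 0 (m + suc k) ⊆ (_∈ X)
    ⊆X (x , x≤ , _ , e) with append-cases m q p x
    ... | inj₁ (x≤m , e′) = subst (_∈ X) (trans (≡.sym e′) e) (q∈X x x≤m)
    ... | inj₂ (x′ , refl , e′) = subst (_∈ X) (trans (≡.sym e′) e) (p∈X x′ (+-cancelˡ-suc-≤ m x≤))

  -- P joins the first two terminals; Q runs from the third terminal to the only vertex q m of Q
  -- meeting the closed neighbourhood of P, whose neighbours on P lie between p s₁ and p s₂.
  record Configuration : Set where
    field
      k : ℕ
      p : ℕ → V G
      P : InducedPath k p
      m : ℕ
      q : ℕ → V G
      Q : InducedPath m q
      p∈X : ∀ x → x ≤ k → p x ∈ X
      q∈X : ∀ y → y ≤ m → q y ∈ X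
      p₀-attaches : A 0F (p 0)
      pₖ-attaches : A 1F (p k)
      q₀-attaches : A 2F (q 0)
      apart : ∀ y → y < m → ∀ x → x ≤ k → q y ≢ p x × ¬ q y ~ p x
      qₘ∉P : ∀ x → x ≤ k → q m ≢ p x
      covered : (_∈ X) ⊆ (OnSegment p 0 k ∪ OnSegment q 0 m)
      s₁ s₂ : ℕ
      s₁≤s₂ : s₁ ≤ s₂
      s₂≤k : s₂ ≤ k
      qₘ~pₛ₁ : q m ~ p s₁
      qₘ~pₛ₂ : q m ~ p s₂
      between : ∀ x → x ≤ k → q m ~ p x → s₁ ≤ x × x ≤ s₂

  module Configured (S : Configuration) where
    open Configuration S public

    q∉P : ∀ y → y ≤ m → ∀ x → x ≤ k → q y ≢ p x
    q∉P y y≤m x x≤k with m≤n⇒m<n∨m≡n y≤m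
    ... | inj₁ y<m = proj₁ (apart y y<m x x≤k)
    ... | inj₂ refl = qₘ∉P x x≤k

    p~q : ∀ x y → x ≤ k → y ≤ m → p x ~ q y → y ≡ m × s₁ ≤ x × x ≤ s₂
    p~q x y x≤k y≤m a with m≤n⇒m<n∨m≡n y≤m
    ... | inj₁ y<m = ⊥-elim (proj₂ (apart y y<m x x≤k) (~-sym a))
    ... | inj₂ refl = refl , between x x≤k (~-sym a)

    neighbours-p : ∀ x → x ≤ k → ∀ {u} → u ∈ X → p x ~ u →
                   (x < k × u ≡ p (suc x)) ⊎ (∃ λ x′ → x ≡ suc x′ × u ≡ p x′) ⊎ (u ≡ q m × s₁ ≤ x × x ≤ s₂)
    neighbours-p x x≤k u∈X a with covered u∈X
    ... | inj₁ (x′ , x′≤k , _ , refl) with consecutive P x≤k x′≤k a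
    ...   | inj₁ refl = inj₁ (x′≤k , refl)
    ...   | inj₂ refl = inj₂ (inj₁ (x′ , refl , refl))
    neighbours-p x x≤k u∈X a | inj₂ (y , y≤m , _ , refl) with p~q x y x≤k y≤m a
    ...   | (refl , s₁≤x , x≤s₂) = inj₂ (inj₂ (refl , s₁≤x , x≤s₂))

    neighbours-q : ∀ y → y ≤ m → ∀ {u} → u ∈ X → q y ~ u →
                   (y < m × u ≡ q (suc y)) ⊎ (∃ λ y′ → y ≡ suc y′ × u ≡ q y′) ⊎
                   (y ≡ m × ∃ λ x → x ≤ k × u ≡ p x × s₁ ≤ x × x ≤ s₂)
    neighbours-q y y≤m u∈X a with covered u∈X
    ... | inj₂ (y′ , y′≤m , _ , refl) with consecutive Q y≤m y′≤m a
    ...   | inj₁ refl = inj₁ (y′≤m , refl)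
    ...   | inj₂ refl = inj₂ (inj₁ (y′ , refl , refl))
    neighbours-q y y≤m u∈X a | inj₁ (x , x≤k , _ , refl) with p~q x y x≤k y≤m (~-sym a)
    ...   | (y≡m , s₁≤x , x≤s₂) = inj₂ (inj₂ (y≡m , x , x≤k , refl , s₁≤x , x≤s₂))

    p₀-sole : 1 ≤ s₂ → SoleAttachment 0F (p 0)
    p₀-sole 1≤s₂ = nonCut⇒sole-for 0F (p∈X 0 z≤n) connected-rest others
      where
      1≤k : 1 ≤ k
      1≤k = ≤-trans 1≤s₂ s₂≤k
      connected-rest : Connectedᵖ (Without (p 0))
      connected-rest = Connectedᵖ-resp (⊆without , without⊆)
        (Connectedᵖ-∪ (segment-connected {lo = 1} P ≤-refl) (segment-connected {lo = 0} Q ≤-refl)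
                      (s₂ , s₂≤k , 1≤s₂ , refl) (m , ≤-refl , z≤n , refl) (~-sym qₘ~pₛ₂))
        where
        ⊆without : (OnSegment p 1 k ∪ OnSegment q 0 m) ⊆ Without (p 0)
        ⊆without (inj₁ (x , x≤k , 1≤x , refl)) = p∈X x x≤k , λ e → <-irrefl (≡.sym (injective P x≤k z≤n e)) 1≤x
        ⊆without (inj₂ (y , y≤m , _ , refl)) = q∈X y y≤m , q∉P y y≤m 0 z≤n
        without⊆ : Without (p 0) ⊆ (OnSegment p 1 k ∪ OnSegment q 0 m)
        without⊆ (u∈X , u≢p₀) with covered u∈X
        ... | inj₂ onQ = inj₂ onQ
        ... | inj₁ (zero , _ , _ , e) = ⊥-elim (u≢p₀ (≡.sym e))
        ... | inj₁ (suc x , x≤k , _ , e) = inj₁ (suc x , x≤k , s≤s z≤n , e)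
      others : ∀ t → t ≢ 0F → Without (p 0) ≬ A t
      others 0F t≢0 = ⊥-elim (t≢0 refl)
      others 1F _ = p k , (p∈X k ≤-refl , λ e → <-irrefl (≡.sym (injective P ≤-refl z≤n e)) 1≤k) , pₖ-attaches
      others 2F _ = q 0 , (q∈X 0 z≤n , q∉P 0 z≤n 0 z≤n) , q₀-attaches

    pₖ-sole : s₁ < k → SoleAttachment 1F (p k)
    pₖ-sole s₁<k = nonCut⇒sole-for 1F (p∈X k ≤-refl) connected-rest others
      where
      1≤k : 1 ≤ k
      1≤k = ≤-trans (s≤s z≤n) s₁<k
      connected-rest : Connectedᵖ (Without (p k))
      connected-rest = Connectedᵖ-resp (⊆without , without⊆)
        (Connectedᵖ-∪ (segment-connected {lo = 0} P pred[n]≤n) (segment-connected {lo = 0} Q ≤-refl)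
                      (s₁ , <⇒≤pred s₁<k , z≤n , refl) (m , ≤-refl , z≤n , refl) (~-sym qₘ~pₛ₁))
        where
        ⊆without : (OnSegment p 0 (pred k) ∪ OnSegment q 0 m) ⊆ Without (p k)
        ⊆without (inj₁ (x , x≤ , _ , refl)) =
          p∈X x (≤pred⇒≤ x≤) , λ e → <-irrefl (injective P (≤pred⇒≤ x≤) ≤-refl e) (≤pred⇒< 1≤k x≤)
        ⊆without (inj₂ (y , y≤m , _ , refl)) = q∈X y y≤m , q∉P y y≤m k ≤-refl
        without⊆ : Without (p k) ⊆ (OnSegment p 0 (pred k) ∪ OnSegment q 0 m)
        without⊆ (u∈X , u≢pₖ) with covered u∈X
        ... | inj₂ onQ = inj₂ onQ
        ... | inj₁ (x , x≤k , _ , e) =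
          inj₁ (x , <⇒≤pred (≤∧≢⇒< x≤k (λ x≡k → u≢pₖ (trans (≡.sym e) (cong p x≡k)))) , z≤n , e)
      others : ∀ t → t ≢ 1F → Without (p k) ≬ A t
      others 0F _ = p 0 , (p∈X 0 z≤n , λ e → <-irrefl (injective P z≤n ≤-refl e) 1≤k) , p₀-attaches
      others 1F t≢1 = ⊥-elim (t≢1 refl)
      others 2F _ = q 0 , (q∈X 0 z≤n , q∉P 0 z≤n k ≤-refl) , q₀-attaches

    q₀-sole : SoleAttachment 2F (q 0)
    q₀-sole = nonCut⇒sole-for 2F (q∈X 0 z≤n) (connected-rest (m ℕ.≟ 0)) others
      where
      ⊆without : OnSegment p 0 k ⊆ Without (q 0)
      ⊆without (x , x≤k , _ , refl) = p∈X x x≤k , λ e → q∉P 0 z≤n x x≤k (≡.sym e)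
      connected-rest : Dec (m ≡ 0) → Connectedᵖ (Without (q 0))
      connected-rest (yes m≡0) = Connectedᵖ-resp (⊆without , without⊆) (segment-connected {lo = 0} P ≤-refl)
        where
        without⊆ : Without (q 0) ⊆ OnSegment p 0 k
        without⊆ (u∈X , u≢q₀) with covered u∈X
        ... | inj₁ onP = onP
        ... | inj₂ (y , y≤m , _ , e) with n≤0⇒n≡0 (subst (y ≤_) m≡0 y≤m)
        ...   | refl = ⊥-elim (u≢q₀ (≡.sym e))
      connected-rest (no m≢0) = Connectedᵖ-resp (⊆without′ , without⊆)
        (Connectedᵖ-∪ (segment-connected {lo = 0} P ≤-refl) (segment-connected {lo = 1} Q ≤-refl)
                      (s₁ , ≤-trans s₁≤s₂ s₂≤k , z≤n , refl) (m , ≤-refl , n≢0⇒n>0 m≢0 , refl) (~-sym qₘ~pₛ₁))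
        where
        ⊆without′ : (OnSegment p 0 k ∪ OnSegment q 1 m) ⊆ Without (q 0)
        ⊆without′ (inj₁ onP) = ⊆without onP
        ⊆without′ (inj₂ (y , y≤m , 1≤y , refl)) = q∈X y y≤m , λ e → <-irrefl (≡.sym (injective Q y≤m z≤n e)) 1≤y
        without⊆ : Without (q 0) ⊆ (OnSegment p 0 k ∪ OnSegment q 1 m)
        without⊆ (u∈X , u≢q₀) with covered u∈X
        ... | inj₁ onP = inj₁ onP
        ... | inj₂ (zero , _ , _ , e) = ⊥-elim (u≢q₀ (≡.sym e))
        ... | inj₂ (suc y , y≤m , _ , e) = inj₂ (suc y , y≤m , s≤s z≤n , e)
      others : ∀ t → t ≢ 2F → Without (q 0) ≬ A t
      others 0F _ = p 0 , (p∈X 0 z≤n , λ e → q∉P 0 z≤n 0 z≤n (≡.sym e)) , p₀-attaches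
      others 1F _ = p k , (p∈X k ≤-refl , λ e → q∉P 0 z≤n k ≤-refl (≡.sym e)) , pₖ-attaches
      others 2F t≢2 = ⊥-elim (t≢2 refl)

    ends : Fin 3 → V G
    ends 0F = p 0
    ends 1F = p k
    ends 2F = q 0

    ends-sole : 1 ≤ s₂ → s₁ < k → ∀ i → SoleAttachment i (ends i)
    ends-sole 1≤s₂ s₁<k 0F = p₀-sole 1≤s₂
    ends-sole 1≤s₂ s₁<k 1F = pₖ-sole s₁<k
    ends-sole 1≤s₂ s₁<k 2F = q₀-sole

    ends∈X : ∀ i → ends i ∈ X
    ends∈X 0F = p∈X 0 z≤n
    ends∈X 1F = p∈X k ≤-refl
    ends∈X 2F = q∈X 0 z≤n

    ends-injective : 1 ≤ k → Injective _≡_ _≡_ ends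
    ends-injective 1≤k {0F} {0F} _ = refl
    ends-injective 1≤k {0F} {1F} e = ⊥-elim (<-irrefl (injective P z≤n ≤-refl e) 1≤k)
    ends-injective 1≤k {0F} {2F} e = ⊥-elim (q∉P 0 z≤n 0 z≤n (≡.sym e))
    ends-injective 1≤k {1F} {0F} e = ⊥-elim (<-irrefl (injective P z≤n ≤-refl (≡.sym e)) 1≤k)
    ends-injective 1≤k {1F} {1F} _ = refl
    ends-injective 1≤k {1F} {2F} e = ⊥-elim (q∉P 0 z≤n k ≤-refl (≡.sym e))
    ends-injective 1≤k {2F} {0F} e = ⊥-elim (q∉P 0 z≤n 0 z≤n e)
    ends-injective 1≤k {2F} {1F} e = ⊥-elim (q∉P 0 z≤n k ≤-refl e)
    ends-injective 1≤k {2F} {2F} _ = refl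

    -- p (suc s₁) could be deleted, as q m would still join the two halves of P.
    no-gap : 2 + s₁ ≤ s₂ → ⊥
    no-gap gap = proj₂ (minimal (without? _) proj₁ connected-rest met (p∈X (suc s₁) 1+s₁≤k)) refl
      where
      1+s₁≤k : suc s₁ ≤ k
      1+s₁≤k = ≤-trans (<⇒≤ gap) s₂≤k
      s₁≤k : s₁ ≤ k
      s₁≤k = ≤-trans (n≤1+n s₁) 1+s₁≤k
      Rest : V G → Set
      Rest = (OnSegment p 0 s₁ ∪ OnSegment q 0 m) ∪ OnSegment p (2 + s₁) k
      ⊆without : Rest ⊆ Without (p (suc s₁))
      ⊆without (inj₁ (inj₁ (x , x≤s₁ , _ , refl))) =
        p∈X x (≤-trans x≤s₁ s₁≤k) , λ e → <-irrefl (injective P (≤-trans x≤s₁ s₁≤k) 1+s₁≤k e) (s≤s x≤s₁)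
      ⊆without (inj₁ (inj₂ (y , y≤m , _ , refl))) = q∈X y y≤m , q∉P y y≤m (suc s₁) 1+s₁≤k
      ⊆without (inj₂ (x , x≤k , 2+s₁≤x , refl)) =
        p∈X x x≤k , λ e → <-irrefl (≡.sym (injective P x≤k 1+s₁≤k e)) 2+s₁≤x
      without⊆ : Without (p (suc s₁)) ⊆ Rest
      without⊆ (u∈X , u≢) with covered u∈X
      ... | inj₂ onQ = inj₁ (inj₂ onQ)
      ... | inj₁ (x , x≤k , _ , e) with x ≤? s₁
      ...   | yes x≤s₁ = inj₁ (inj₁ (x , x≤s₁ , z≤n , e))
      ...   | no x≰s₁ = inj₂ (x , x≤k , ≤∧≢⇒< (≰⇒> x≰s₁) (λ x≡ → u≢ (trans (≡.sym e) (cong p (≡.sym x≡)))) , e)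
      connected-rest : Connectedᵖ (Without (p (suc s₁)))
      connected-rest = Connectedᵖ-resp (⊆without , without⊆)
        (Connectedᵖ-∪ (Connectedᵖ-∪ (segment-connected {lo = 0} P s₁≤k) (segment-connected {lo = 0} Q ≤-refl)
                                    (s₁ , ≤-refl , z≤n , refl) (m , ≤-refl , z≤n , refl) (~-sym qₘ~pₛ₁))
                      (segment-connected {lo = 2 + s₁} P ≤-refl)
                      (inj₂ (m , ≤-refl , z≤n , refl)) (s₂ , s₂≤k , gap , refl) qₘ~pₛ₂)
      met : ∀ t → Without (p (suc s₁)) ≬ A t
      met 0F = p 0 , (p∈X 0 z≤n , λ e → 0≢1+n (injective P z≤n 1+s₁≤k e)) , p₀-attaches
      met 1F = p k , (p∈X k ≤-refl , λ e → <-irrefl (≡.sym (injective P ≤-refl 1+s₁≤k e)) (≤-trans gap s₂≤k)) ,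
               pₖ-attaches
      met 2F = q 0 , (q∈X 0 z≤n , q∉P 0 z≤n (suc s₁) 1+s₁≤k) , q₀-attaches

    module Tripod (s₂≡s₁ : s₂ ≡ s₁) (0<s₁ : 0 < s₁) (s₁<k : s₁ < k) where

      s₁≤k : s₁ ≤ k
      s₁≤k = <⇒≤ s₁<k

      1≤k : 1 ≤ k
      1≤k = ≤-trans (s≤s z≤n) s₁<k

      neighbours-p′ : ∀ x → x ≤ k → ∀ {u} → u ∈ X → p x ~ u →
                      (x < k × u ≡ p (suc x)) ⊎ (0 < x × u ≡ p (pred x)) ⊎ (u ≡ q m × x ≡ s₁)
      neighbours-p′ x x≤k u∈X a with neighbours-p x x≤k u∈X a
      ... | inj₁ next = inj₁ next
      ... | inj₂ (inj₁ (_ , refl , e)) = inj₂ (inj₁ (s≤s z≤n , e))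
      ... | inj₂ (inj₂ (e , s₁≤x , x≤s₂)) = inj₂ (inj₂ (e , ≤-antisym (subst (x ≤_) s₂≡s₁ x≤s₂) s₁≤x))

      neighbours-q′ : ∀ y → y ≤ m → ∀ {u} → u ∈ X → q y ~ u →
                      (y < m × u ≡ q (suc y)) ⊎ (0 < y × u ≡ q (pred y)) ⊎ (y ≡ m × u ≡ p s₁)
      neighbours-q′ y y≤m u∈X a with neighbours-q y y≤m u∈X a
      ... | inj₁ next = inj₁ next
      ... | inj₂ (inj₁ (_ , refl , e)) = inj₂ (inj₁ (s≤s z≤n , e))
      ... | inj₂ (inj₂ (y≡m , x , _ , e , s₁≤x , x≤s₂)) =
        inj₂ (inj₂ (y≡m , trans e (cong p (≤-antisym (subst (x ≤_) s₂≡s₁ x≤s₂) s₁≤x))))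

      Leaf : V G → Set
      Leaf v = ∃ λ i → ends i ≡ v

      Kind : V G → Set
      Kind v = (deg G X v ≡ 1 × Leaf v) ⊎ (deg G X v ≡ 2 × ¬ Leaf v × v ≢ p s₁) ⊎ (deg G X v ≡ 3 × v ≡ p s₁)

      inner-p-not-leaf : ∀ x → x ≤ k → 0 < x → x < k → ¬ Leaf (p x)
      inner-p-not-leaf x x≤k 0<x x<k (0F , e) = <-irrefl (injective P z≤n x≤k e) 0<x
      inner-p-not-leaf x x≤k 0<x x<k (1F , e) = <-irrefl (injective P x≤k ≤-refl (≡.sym e)) x<k
      inner-p-not-leaf x x≤k 0<x x<k (2F , e) = q∉P 0 z≤n x x≤k e

      inner-q-not-leaf : ∀ y → y ≤ m → 0 < y → ¬ Leaf (q y)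
      inner-q-not-leaf y y≤m 0<y (0F , e) = q∉P y y≤m 0 z≤n (≡.sym e)
      inner-q-not-leaf y y≤m 0<y (1F , e) = q∉P y y≤m k ≤-refl (≡.sym e)
      inner-q-not-leaf y y≤m 0<y (2F , e) = <-irrefl (injective Q z≤n y≤m e) 0<y

      pred<suc : ∀ {x} → 0 < x → pred x < suc x
      pred<suc {suc x} _ = ≤-trans (n≤1+n (suc x)) ≤-refl

      kind-p₀ : Kind (p 0)
      kind-p₀ = inj₁ (deg≡1 (p∈X 1 1≤k) (edge P 0 1≤k) only , 0F , refl)
        where
        only : ∀ {u} → u ∈ X → p 0 ~ u → u ≡ p 1
        only u∈X a with neighbours-p′ 0 z≤n u∈X a
        ... | inj₁ (_ , e) = e
        ... | inj₂ (inj₁ (() , _))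
        ... | inj₂ (inj₂ (_ , 0≡s₁)) = ⊥-elim (<-irrefl 0≡s₁ 0<s₁)

      kind-pₖ : Kind (p k)
      kind-pₖ = inj₁ (deg≡1 (p∈X (pred k) pred[n]≤n) (edge⁻ P 1≤k ≤-refl) only , 1F , refl)
        where
        only : ∀ {u} → u ∈ X → p k ~ u → u ≡ p (pred k)
        only u∈X a with neighbours-p′ k ≤-refl u∈X a
        ... | inj₁ (k<k , _) = ⊥-elim (<-irrefl refl k<k)
        ... | inj₂ (inj₁ (_ , e)) = e
        ... | inj₂ (inj₂ (_ , k≡s₁)) = ⊥-elim (<-irrefl (≡.sym k≡s₁) s₁<k)

      centre-degree : deg G X (p s₁) ≡ 3
      centre-degree =
        deg≡3 before≢after (λ e → qₘ∉P (pred s₁) pred≤k (≡.sym e)) (λ e → qₘ∉P (suc s₁) s₁<k (≡.sym e))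
              (p∈X (pred s₁) pred≤k) (p∈X (suc s₁) s₁<k) (q∈X m ≤-refl)
              (edge⁻ P 0<s₁ s₁≤k) (edge P s₁ s₁<k) (~-sym qₘ~pₛ₁) only
        where
        pred≤k : pred s₁ ≤ k
        pred≤k = ≤-trans pred[n]≤n s₁≤k
        before≢after : p (pred s₁) ≢ p (suc s₁)
        before≢after e = <-irrefl (injective P pred≤k s₁<k e) (pred<suc 0<s₁)
        only : ∀ {u} → u ∈ X → p s₁ ~ u → u ≡ p (pred s₁) ⊎ u ≡ p (suc s₁) ⊎ u ≡ q m
        only u∈X a with neighbours-p′ s₁ s₁≤k u∈X a
        ... | inj₁ (_ , e) = inj₂ (inj₁ e)
        ... | inj₂ (inj₁ (_ , e)) = inj₁ e
        ... | inj₂ (inj₂ (e , _)) = inj₂ (inj₂ e)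

      kind-p-inner : ∀ x → x ≤ k → 0 < x → x < k → x ≢ s₁ → Kind (p x)
      kind-p-inner x x≤k 0<x x<k x≢s₁ =
        inj₂ (inj₁ (deg≡2 before≢after (p∈X (pred x) pred≤k) (p∈X (suc x) x<k)
                          (edge⁻ P 0<x x≤k) (edge P x x<k) only ,
                    inner-p-not-leaf x x≤k 0<x x<k , λ e → x≢s₁ (injective P x≤k s₁≤k e)))
        where
        pred≤k : pred x ≤ k
        pred≤k = ≤-trans pred[n]≤n x≤k
        before≢after : p (pred x) ≢ p (suc x)
        before≢after e = <-irrefl (injective P pred≤k x<k e) (pred<suc 0<x)
        only : ∀ {u} → u ∈ X → p x ~ u → u ≡ p (pred x) ⊎ u ≡ p (suc x)
        only u∈X a with neighbours-p′ x x≤k u∈X a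
        ... | inj₁ (_ , e) = inj₂ e
        ... | inj₂ (inj₁ (_ , e)) = inj₁ e
        ... | inj₂ (inj₂ (_ , x≡s₁)) = ⊥-elim (x≢s₁ x≡s₁)

      kind-p : ∀ x → x ≤ k → Kind (p x)
      kind-p zero _ = kind-p₀
      kind-p x@(suc _) x≤k with x ℕ.≟ k | x ℕ.≟ s₁
      ... | yes refl | _ = kind-pₖ
      ... | no _ | yes refl = inj₂ (inj₂ (centre-degree , refl))
      ... | no x≢k | no x≢s₁ = kind-p-inner x x≤k (s≤s z≤n) (≤∧≢⇒< x≤k x≢k) x≢s₁

      kind-q₀ : Kind (q 0)
      kind-q₀ with m ℕ.≟ 0
      ... | yes m≡0 = inj₁ (deg≡1 (p∈X s₁ s₁≤k) (subst (λ z → q z ~ p s₁) m≡0 qₘ~pₛ₁) only , 2F , refl)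
        where
        only : ∀ {u} → u ∈ X → q 0 ~ u → u ≡ p s₁
        only u∈X a with neighbours-q′ 0 z≤n u∈X a
        ... | inj₁ (0<m , _) = ⊥-elim (<-irrefl (≡.sym m≡0) 0<m)
        ... | inj₂ (inj₁ (() , _))
        ... | inj₂ (inj₂ (_ , e)) = e
      ... | no m≢0 = inj₁ (deg≡1 (q∈X 1 1≤m) (edge Q 0 1≤m) only , 2F , refl)
        where
        1≤m : 1 ≤ m
        1≤m = n≢0⇒n>0 m≢0
        only : ∀ {u} → u ∈ X → q 0 ~ u → u ≡ q 1
        only u∈X a with neighbours-q′ 0 z≤n u∈X a
        ... | inj₁ (_ , e) = e
        ... | inj₂ (inj₁ (() , _))
        ... | inj₂ (inj₂ (0≡m , _)) = ⊥-elim (m≢0 (≡.sym 0≡m))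

      kind-qₘ : 0 < m → Kind (q m)
      kind-qₘ 0<m = inj₂ (inj₁ (deg≡2 (q∉P (pred m) pred[n]≤n s₁ s₁≤k) (q∈X (pred m) pred[n]≤n) (p∈X s₁ s₁≤k)
                                       (edge⁻ Q 0<m ≤-refl) qₘ~pₛ₁ only ,
                                inner-q-not-leaf m ≤-refl 0<m , qₘ∉P s₁ s₁≤k))
        where
        only : ∀ {u} → u ∈ X → q m ~ u → u ≡ q (pred m) ⊎ u ≡ p s₁
        only u∈X a with neighbours-q′ m ≤-refl u∈X a
        ... | inj₁ (m<m , _) = ⊥-elim (<-irrefl refl m<m)
        ... | inj₂ (inj₁ (_ , e)) = inj₁ e
        ... | inj₂ (inj₂ (_ , e)) = inj₂ e

      kind-q-inner : ∀ y → 0 < y → y < m → Kind (q y)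
      kind-q-inner y 0<y y<m =
        inj₂ (inj₁ (deg≡2 before≢after (q∈X (pred y) pred≤m) (q∈X (suc y) y<m)
                          (edge⁻ Q 0<y (<⇒≤ y<m)) (edge Q y y<m) only ,
                    inner-q-not-leaf y (<⇒≤ y<m) 0<y , q∉P y (<⇒≤ y<m) s₁ s₁≤k))
        where
        pred≤m : pred y ≤ m
        pred≤m = ≤-trans pred[n]≤n (<⇒≤ y<m)
        before≢after : q (pred y) ≢ q (suc y)
        before≢after e = <-irrefl (injective Q pred≤m y<m e) (pred<suc 0<y)
        only : ∀ {u} → u ∈ X → q y ~ u → u ≡ q (pred y) ⊎ u ≡ q (suc y)
        only u∈X a with neighbours-q′ y (<⇒≤ y<m) u∈X a
        ... | inj₁ (_ , e) = inj₂ e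
        ... | inj₂ (inj₁ (_ , e)) = inj₁ e
        ... | inj₂ (inj₂ (y≡m , _)) = ⊥-elim (<-irrefl y≡m y<m)

      kind-q : ∀ y → y ≤ m → Kind (q y)
      kind-q zero _ = kind-q₀
      kind-q y@(suc _) y≤m with y ℕ.≟ m
      ... | yes refl = kind-qₘ (s≤s z≤n)
      ... | no y≢m = kind-q-inner y (s≤s z≤n) (≤∧≢⇒< y≤m y≢m)

      kind : ∀ {v} → v ∈ X → Kind v
      kind v∈X with covered v∈X
      ... | inj₁ (x , x≤k , _ , refl) = kind-p x x≤k
      ... | inj₂ (y , y≤m , _ , refl) = kind-q y y≤m

      -- Ranks grow along P and from q m back to q 0, q m ranking just above p s₁, so every vertex
      -- has at most one neighbour of rank at most its own.
      q-rank : ℕ → ℕ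
      q-rank y = suc s₁ + (m ∸ y)

      Rank : V G → ℕ → Set
      Rank v r = (∃ λ x → x ≤ k × p x ≡ v × r ≡ x) ⊎ (∃ λ y → y ≤ m × q y ≡ v × r ≡ q-rank y)

      rank : ∀ {v} → v ∈ X → ∃ (Rank v)
      rank v∈X with covered v∈X
      ... | inj₁ (x , x≤k , _ , e) = x , inj₁ (x , x≤k , e , refl)
      ... | inj₂ (y , y≤m , _ , e) = q-rank y , inj₂ (y , y≤m , e , refl)

      rank-p : ∀ {x r} → x ≤ k → Rank (p x) r → r ≡ x
      rank-p x≤k (inj₁ (x′ , x′≤k , e , refl)) = injective P x′≤k x≤k e
      rank-p x≤k (inj₂ (y , y≤m , e , _)) = ⊥-elim (q∉P y y≤m _ x≤k e)

      rank-q : ∀ {y r} → y ≤ m → Rank (q y) r → r ≡ q-rank y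
      rank-q y≤m (inj₁ (x , x≤k , e , _)) = ⊥-elim (q∉P _ y≤m x x≤k (≡.sym e))
      rank-q y≤m (inj₂ (y′ , y′≤m , e , refl)) = cong q-rank (injective Q y′≤m y≤m e)

      q-rank-pred : ∀ {y} → 0 < y → y ≤ m → q-rank y < q-rank (pred y)
      q-rank-pred {suc y} _ y<m = +-monoʳ-< (suc s₁) (∸-monoʳ-< ≤-refl y<m)

      parent-p : ∀ x → x ≤ k → ∀ {u r} → u ∈ X → Rank u r → p x ~ u → r ≤ x → u ≡ p (pred x)
      parent-p x x≤k u∈X R a r≤x with neighbours-p′ x x≤k u∈X a
      ... | inj₁ (x<k , refl) = ⊥-elim (<-irrefl refl (subst (_≤ x) (rank-p x<k R) r≤x))
      ... | inj₂ (inj₁ (_ , e)) = e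
      ... | inj₂ (inj₂ (refl , refl)) =
        ⊥-elim (<-irrefl refl (≤-trans (s≤s (m≤m+n s₁ (m ∸ m))) (subst (_≤ s₁) (rank-q ≤-refl R) r≤x)))

      parent-q : ∀ y → y < m → ∀ {u r} → u ∈ X → Rank u r → q y ~ u → r ≤ q-rank y → u ≡ q (suc y)
      parent-q y y<m u∈X R a r≤ with neighbours-q′ y (<⇒≤ y<m) u∈X a
      ... | inj₁ (_ , e) = e
      ... | inj₂ (inj₁ (0<y , refl)) = ⊥-elim (<-irrefl refl (<-≤-trans (q-rank-pred 0<y (<⇒≤ y<m))
                                         (subst (_≤ q-rank y) (rank-q (≤-trans pred[n]≤n (<⇒≤ y<m)) R) r≤)))
      ... | inj₂ (inj₂ (refl , _)) = ⊥-elim (<-irrefl refl y<m)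

      parent-qₘ : ∀ {u r} → u ∈ X → Rank u r → q m ~ u → r ≤ q-rank m → u ≡ p s₁
      parent-qₘ u∈X R a r≤ with neighbours-q′ m ≤-refl u∈X a
      ... | inj₁ (m<m , _) = ⊥-elim (<-irrefl refl m<m)
      ... | inj₂ (inj₁ (0<m , refl)) = ⊥-elim (<-irrefl refl (<-≤-trans (q-rank-pred 0<m ≤-refl)
                                         (subst (_≤ q-rank m) (rank-q pred[n]≤n R) r≤)))
      ... | inj₂ (inj₂ (_ , e)) = e

      parent-unique : ∀ {v r u₁ r₁ u₂ r₂} → u₁ ∈ X → u₂ ∈ X → Rank v r → Rank u₁ r₁ → Rank u₂ r₂ →
                      v ~ u₁ → v ~ u₂ → r₁ ≤ r → r₂ ≤ r → u₁ ≡ u₂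
      parent-unique u₁∈X u₂∈X (inj₁ (x , x≤k , refl , refl)) R₁ R₂ a₁ a₂ r₁≤ r₂≤ =
        trans (parent-p x x≤k u₁∈X R₁ a₁ r₁≤) (≡.sym (parent-p x x≤k u₂∈X R₂ a₂ r₂≤))
      parent-unique u₁∈X u₂∈X (inj₂ (y , y≤m , refl , refl)) R₁ R₂ a₁ a₂ r₁≤ r₂≤ with m≤n⇒m<n∨m≡n y≤m
      ... | inj₁ y<m = trans (parent-q y y<m u₁∈X R₁ a₁ r₁≤) (≡.sym (parent-q y y<m u₂∈X R₂ a₂ r₂≤))
      ... | inj₂ refl = trans (parent-qₘ u₁∈X R₁ a₁ r₁≤) (≡.sym (parent-qₘ u₂∈X R₂ a₂ r₂≤))

      isTripod : IsTripod G X ends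
      isTripod = ((p 0 , p∈X 0 z≤n) , Connectedᵖ⇒Connected connected , ranked⇒acyclic X Rank rank parent-unique) ,
                 deg≤3 , (p s₁ , p∈X s₁ s₁≤k , centre-degree , centre-only) , ends-injective 1≤k , leaves , ends∈X
        where
        deg≤3 : ∀ v → v ∈ X → deg G X v ≤ 3
        deg≤3 v v∈X with kind v∈X
        ... | inj₁ (d , _) = subst (_≤ 3) (≡.sym d) (s≤s z≤n)
        ... | inj₂ (inj₁ (d , _)) = subst (_≤ 3) (≡.sym d) (s≤s (s≤s z≤n))
        ... | inj₂ (inj₂ (d , _)) = subst (_≤ 3) (≡.sym d) ≤-refl
        centre-only : ∀ v → v ∈ X → deg G X v ≡ 3 → v ≡ p s₁
        centre-only v v∈X d≡3 with kind v∈X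
        ... | inj₁ (d , _) with trans (≡.sym d) d≡3
        ...   | ()
        centre-only v v∈X d≡3 | inj₂ (inj₁ (d , _)) with trans (≡.sym d) d≡3
        ...   | ()
        centre-only v v∈X d≡3 | inj₂ (inj₂ (_ , e)) = e
        leaves : ∀ v → v ∈ X → (deg G X v ≡ 1 ⇔ Leaf v)
        leaves v v∈X with kind v∈X
        ... | inj₁ (d , leaf) = mk⇔ (λ _ → leaf) (λ _ → d)
        ... | inj₂ (inj₁ (d , ¬leaf , _)) = mk⇔ (λ d≡1 → ⊥-elim (2≢1 (trans (≡.sym d) d≡1)))
                                                (λ leaf → ⊥-elim (¬leaf leaf))
          where
          2≢1 : 2 ≢ 1
          2≢1 ()
        ... | inj₂ (inj₂ (d , refl)) = mk⇔ (λ d≡1 → ⊥-elim (3≢1 (trans (≡.sym d) d≡1)))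
                                           (λ leaf → ⊥-elim (inner-p-not-leaf s₁ s₁≤k 0<s₁ s₁<k leaf))
          where
          3≢1 : 3 ≢ 1
          3≢1 ()

    module Triangle (s₂≡1+s₁ : s₂ ≡ suc s₁) where

      1+s₁≤k : suc s₁ ≤ k
      1+s₁≤k = subst (_≤ k) s₂≡1+s₁ s₂≤k

      s₁≤k : s₁ ≤ k
      s₁≤k = ≤-trans (n≤1+n s₁) 1+s₁≤k

      Part : Fin 3 → V G → Set
      Part 0F = OnSegment p 0 s₁
      Part 1F = OnSegment p (suc s₁) k
      Part 2F = OnSegment q 0 m

      part? : ∀ i → Decidable (Part i)
      part? 0F = onSegment? p 0 s₁
      part? 1F = onSegment? p (suc s₁) k
      part? 2F = onSegment? q 0 m

      parts : Fin 3 → Subset (n G)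
      parts i = toSubset (part? i)

      corner : Fin 3 → V G
      corner 0F = p s₁
      corner 1F = p (suc s₁)
      corner 2F = q m

      part⊆X : ∀ i → Part i ⊆ (_∈ X)
      part⊆X 0F (x , x≤s₁ , _ , e) = subst (_∈ X) e (p∈X x (≤-trans x≤s₁ s₁≤k))
      part⊆X 1F (x , x≤k , _ , e) = subst (_∈ X) e (p∈X x x≤k)
      part⊆X 2F (y , y≤m , _ , e) = subst (_∈ X) e (q∈X y y≤m)

      partition : ∀ v → (v ∈ X ⇔ ∃ λ i → v ∈ parts i)
      partition v = mk⇔ which (λ (i , v∈) → part⊆X i (∈-toSubset⁻ (part? i) v∈))
        where
        which : v ∈ X → ∃ λ i → v ∈ parts i
        which v∈X with covered v∈X
        ... | inj₂ onQ = 2F , ∈-toSubset⁺ (part? 2F) onQ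
        ... | inj₁ (x , x≤k , _ , e) with x ≤? s₁
        ...   | yes x≤s₁ = 0F , ∈-toSubset⁺ (part? 0F) (x , x≤s₁ , z≤n , e)
        ...   | no x≰s₁ = 1F , ∈-toSubset⁺ (part? 1F) (x , x≤k , ≰⇒> x≰s₁ , e)

      before∩after : ∀ {v} → Part 0F v → Part 1F v → ⊥
      before∩after (x , x≤s₁ , _ , refl) (x′ , x′≤k , s₁<x′ , e) =
        <-irrefl refl (≤-trans s₁<x′ (subst (_≤ s₁) (≡.sym (injective P x′≤k (≤-trans x≤s₁ s₁≤k) e)) x≤s₁))

      P∩Q : ∀ {i v} → i ≢ 2F → Part i v → Part 2F v → ⊥
      P∩Q {0F} _ (x , x≤s₁ , _ , refl) (y , y≤m , _ , e) = q∉P y y≤m x (≤-trans x≤s₁ s₁≤k) e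
      P∩Q {1F} _ (x , x≤k , _ , refl) (y , y≤m , _ , e) = q∉P y y≤m x x≤k e
      P∩Q {2F} i≢2 = ⊥-elim (i≢2 refl)

      parts-disjoint : ∀ i j → i ≢ j → ∀ v → v ∈ parts i → v ∉ parts j
      parts-disjoint i j i≢j v v∈i v∈j = apart′ i j i≢j (∈-toSubset⁻ (part? i) v∈i) (∈-toSubset⁻ (part? j) v∈j)
        where
        apart′ : ∀ i j → i ≢ j → Part i v → Part j v → ⊥
        apart′ 0F 1F _ = before∩after
        apart′ 1F 0F _ = λ after before → before∩after before after
        apart′ 0F 2F _ = P∩Q {0F} (λ ())
        apart′ 2F 0F _ = λ onQ onP → P∩Q {0F} (λ ()) onP onQ
        apart′ 1F 2F _ = P∩Q {1F} (λ ())
        apart′ 2F 1F _ = λ onQ onP → P∩Q {1F} (λ ()) onP onQ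
        apart′ 0F 0F i≢j = ⊥-elim (i≢j refl)
        apart′ 1F 1F i≢j = ⊥-elim (i≢j refl)
        apart′ 2F 2F i≢j = ⊥-elim (i≢j refl)

      parts≐ : ∀ i → (_∈ parts i) ≐ Part i
      parts≐ i = ∈-toSubset⁻ (part? i) , ∈-toSubset⁺ (part? i)

      part-path : ∀ i → IsPath G (parts i) (corner i) (ends i)
      part-path 0F = IsPath-reverse {G} (segment⇒IsPath (parts 0F) P z≤n s₁≤k (parts≐ 0F))
      part-path 1F = segment⇒IsPath (parts 1F) P 1+s₁≤k ≤-refl (parts≐ 1F)
      part-path 2F = IsPath-reverse {G} (segment⇒IsPath (parts 2F) Q z≤n ≤-refl (parts≐ 2F))

      swap⇔ : ∀ {a b a′ b′} → (a ~ b ⇔ (a ≡ a′ × b ≡ b′)) → (b ~ a ⇔ (b ≡ b′ × a ≡ a′))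
      swap⇔ h = mk⇔ (λ b~a → let (e₁ , e₂) = Equivalence.to h (~-sym b~a) in e₂ , e₁)
                    (λ (e₂ , e₁) → ~-sym (Equivalence.from h (e₁ , e₂)))

      cross₀₁ : ∀ {a b} → Part 0F a → Part 1F b → (a ~ b ⇔ (a ≡ p s₁ × b ≡ p (suc s₁)))
      cross₀₁ (x , x≤s₁ , _ , refl) (x′ , x′≤k , s₁<x′ , refl) =
        mk⇔ to (λ (e₁ , e₂) → subst₂ _~_ (≡.sym e₁) (≡.sym e₂) (edge P s₁ 1+s₁≤k))
        where
        to : p x ~ p x′ → p x ≡ p s₁ × p x′ ≡ p (suc s₁)
        to a with consecutive P (≤-trans x≤s₁ s₁≤k) x′≤k a
        ... | inj₁ refl = let x≡s₁ = ≤-antisym x≤s₁ (≤-pred s₁<x′) in cong p x≡s₁ , cong (p ∘ suc) x≡s₁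
        ... | inj₂ refl = ⊥-elim (<-irrefl refl (≤-trans s₁<x′ (≤-trans (n≤1+n _) x≤s₁)))

      cross₀₂ : ∀ {a b} → Part 0F a → Part 2F b → (a ~ b ⇔ (a ≡ p s₁ × b ≡ q m))
      cross₀₂ (x , x≤s₁ , _ , refl) (y , y≤m , _ , refl) =
        mk⇔ to (λ (e₁ , e₂) → subst₂ _~_ (≡.sym e₁) (≡.sym e₂) (~-sym qₘ~pₛ₁))
        where
        to : p x ~ q y → p x ≡ p s₁ × q y ≡ q m
        to a with p~q x y (≤-trans x≤s₁ s₁≤k) y≤m a
        ... | (refl , s₁≤x , _) = cong p (≤-antisym x≤s₁ s₁≤x) , refl

      cross₁₂ : ∀ {a b} → Part 1F a → Part 2F b → (a ~ b ⇔ (a ≡ p (suc s₁) × b ≡ q m))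
      cross₁₂ (x , x≤k , s₁<x , refl) (y , y≤m , _ , refl) =
        mk⇔ to (λ (e₁ , e₂) → subst₂ _~_ (≡.sym e₁) (≡.sym e₂) (subst (λ z → p z ~ q m) s₂≡1+s₁ (~-sym qₘ~pₛ₂)))
        where
        to : p x ~ q y → p x ≡ p (suc s₁) × q y ≡ q m
        to a with p~q x y x≤k y≤m a
        ... | (refl , _ , x≤s₂) = cong p (≤-antisym (subst (x ≤_) s₂≡1+s₁ x≤s₂) s₁<x) , refl

      cross : ∀ i j → i ≢ j → ∀ a b → a ∈ parts i → b ∈ parts j → (a ~ b ⇔ (a ≡ corner i × b ≡ corner j))
      cross i j i≢j a b a∈ b∈ = cross′ i j i≢j (∈-toSubset⁻ (part? i) a∈) (∈-toSubset⁻ (part? j) b∈)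
        where
        cross′ : ∀ i j → i ≢ j → Part i a → Part j b → (a ~ b ⇔ (a ≡ corner i × b ≡ corner j))
        cross′ 0F 1F _ ha hb = cross₀₁ ha hb
        cross′ 1F 0F _ ha hb = swap⇔ (cross₀₁ hb ha)
        cross′ 0F 2F _ ha hb = cross₀₂ ha hb
        cross′ 2F 0F _ ha hb = swap⇔ (cross₀₂ hb ha)
        cross′ 1F 2F _ ha hb = cross₁₂ ha hb
        cross′ 2F 1F _ ha hb = swap⇔ (cross₁₂ hb ha)
        cross′ 0F 0F i≢j = ⊥-elim (i≢j refl)
        cross′ 1F 1F i≢j = ⊥-elim (i≢j refl)
        cross′ 2F 2F i≢j = ⊥-elim (i≢j refl)

      isTriangleTripod : IsTriangleTripod G X ends
      isTriangleTripod = parts , corner , partition , parts-disjoint , part-path , cross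

    joined-at-start : s₂ ≡ s₁ → s₁ ≡ 0 → Shape
    joined-at-start s₂≡s₁ s₁≡0 =
      joined⇒shape P Q p∈X q∈X apart qₘ∉P (subst (λ x → q m ~ p x) s₁≡0 qₘ~pₛ₁) only covered
      where
      only : ∀ x → x ≤ k → q m ~ p x → x ≡ 0
      only x x≤k a = n≤0⇒n≡0 (subst (x ≤_) (trans s₂≡s₁ s₁≡0) (proj₂ (between x x≤k a)))

    joined-at-end : s₁ ≡ k → Shape
    joined-at-end s₁≡k =
      joined⇒shape (reverse P) Q (λ x _ → p∈X (k ∸ x) (m∸n≤m k x)) q∈X
                   (λ y y<m x _ → apart y y<m (k ∸ x) (m∸n≤m k x)) (λ x _ → qₘ∉P (k ∸ x) (m∸n≤m k x))
                   (subst (λ x → q m ~ p x) s₁≡k qₘ~pₛ₁) only covered′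
      where
      only : ∀ x → x ≤ k → q m ~ p (k ∸ x) → x ≡ 0
      only x x≤k a = m≤n⇒n≤n∸m⇒m≡0 x≤k (subst (_≤ k ∸ x) s₁≡k (proj₁ (between (k ∸ x) (m∸n≤m k x) a)))
      covered′ : (_∈ X) ⊆ (OnSegment (λ x → p (k ∸ x)) 0 k ∪ OnSegment q 0 m)
      covered′ v∈X with covered v∈X
      ... | inj₁ (x , x≤k , _ , e) = inj₁ (k ∸ x , m∸n≤m k x , z≤n , trans (cong p (m∸[m∸n]≡n x≤k)) e)
      ... | inj₂ onQ = inj₂ onQ

    shape : Shape
    shape with ≤⇒≡⊎≡suc⊎2+≤ s₁≤s₂
    ... | inj₂ (inj₂ gap) = ⊥-elim (no-gap gap)
    ... | inj₂ (inj₁ s₂≡1+s₁) =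
      inj₂ (inj₂ (ends , ends-sole (subst (1 ≤_) (≡.sym s₂≡1+s₁) (s≤s z≤n)) (Triangle.1+s₁≤k s₂≡1+s₁) ,
                  inj₂ (Triangle.isTriangleTripod s₂≡1+s₁)))
    ... | inj₁ s₂≡s₁ with s₁ ℕ.≟ 0 | s₁ ℕ.≟ k
    ...   | yes s₁≡0 | _ = joined-at-start s₂≡s₁ s₁≡0
    ...   | no _ | yes s₁≡k = joined-at-end s₁≡k
    ...   | no s₁≢0 | no s₁≢k =
      inj₂ (inj₂ (ends , ends-sole (subst (1 ≤_) (≡.sym s₂≡s₁) (n≢0⇒n>0 s₁≢0)) s₁<k ,
                  inj₁ (Tripod.isTripod s₂≡s₁ (n≢0⇒n>0 s₁≢0) s₁<k)))
      where
      s₁<k : s₁ < k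
      s₁<k = ≤∧≢⇒< (≤-trans s₁≤s₂ s₂≤k) s₁≢k

  Near : ℕ → (ℕ → V G) → V G → Set
  Near k p v = ∃≤ (λ x → p x ≡ v ⊎ v ~ p x) k

  near? : ∀ k p → Decidable (Near k p)
  near? k p v = ∃≤? (λ x → (p x Fin.≟ v) ⊎-dec (v ~? p x)) k

  configure : ∀ {k p} → InducedPath k p → (∀ x → x ≤ k → p x ∈ X) → A 0F (p 0) → A 1F (p k) →
              ¬ ∃≤ (λ x → A 2F (p x)) k → ∀ {c} → Near k p c →
              ∀ {m q} → InducedPath m q → A 2F (q 0) → q m ≡ c →
              (∀ y → y ≤ m → q y ∈ X × (¬ Near k p (q y) ⊎ q y ≡ c)) → Configuration
  configure {k} {p} P p∈X A₀ A₁ unmet {c} near-c {m} {q} Q A₂ qₘ≡c q-ok = record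
    { k = k ; p = p ; P = P ; m = m ; q = q ; Q = Q ; p∈X = p∈X ; q∈X = λ y y≤m → proj₁ (q-ok y y≤m)
    ; p₀-attaches = A₀ ; pₖ-attaches = A₁ ; q₀-attaches = A₂ ; apart = apart ; qₘ∉P = qₘ∉P ; covered = covered
    ; s₁ = s₁ ; s₂ = s₂ ; s₁≤s₂ = proj₁ (between s₂ (proj₁ (proj₂ last)) (proj₁ (proj₂ (proj₂ last))))
    ; s₂≤k = proj₁ (proj₂ last) ; qₘ~pₛ₁ = proj₁ (proj₂ first) ; qₘ~pₛ₂ = proj₁ (proj₂ (proj₂ last))
    ; between = between }
    where
    apart : ∀ y → y < m → ∀ x → x ≤ k → q y ≢ p x × ¬ q y ~ p x
    apart y y<m x x≤k with proj₂ (q-ok y (<⇒≤ y<m))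
    ... | inj₁ far = (λ e → far (x , x≤k , inj₁ (≡.sym e))) , (λ a → far (x , x≤k , inj₂ a))
    ... | inj₂ q≡c = ⊥-elim (<-irrefl (injective Q (<⇒≤ y<m) ≤-refl (trans q≡c (≡.sym qₘ≡c))) y<m)
    qₘ∉P : ∀ x → x ≤ k → q m ≢ p x
    qₘ∉P = last-off Q (λ x x≤k e → unmet (x , x≤k , subst (A 2F) e A₂)) apart
    touches : ∃≤ (λ x → q m ~ p x) k
    touches = neighbour near-c
      where
      neighbour : Near k p c → ∃≤ (λ x → q m ~ p x) k
      neighbour (x , x≤k , inj₁ e) = ⊥-elim (qₘ∉P x x≤k (trans qₘ≡c (≡.sym e)))
      neighbour (x , x≤k , inj₂ a) = x , x≤k , subst (_~ p x) (≡.sym qₘ≡c) a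
    covered : (_∈ X) ⊆ (OnSegment p 0 k ∪ OnSegment q 0 m)
    covered = minimal (λ v → onSegment? p 0 k v ⊎-dec onSegment? q 0 m v) P∪Q⊆X
      (Connectedᵖ-∪ (segment-connected P ≤-refl) (segment-connected Q ≤-refl)
                    (proj₁ touches , proj₁ (proj₂ touches) , z≤n , refl) (m , ≤-refl , z≤n , refl)
                    (~-sym (proj₂ (proj₂ touches))))
      met
      where
      P∪Q⊆X : (OnSegment p 0 k ∪ OnSegment q 0 m) ⊆ (_∈ X)
      P∪Q⊆X (inj₁ (x , x≤k , _ , e)) = subst (_∈ X) e (p∈X x x≤k)
      P∪Q⊆X (inj₂ (y , y≤m , _ , e)) = subst (_∈ X) e (proj₁ (q-ok y y≤m))
      met : ∀ t → (OnSegment p 0 k ∪ OnSegment q 0 m) ≬ A t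
      met 0F = p 0 , inj₁ (0 , z≤n , z≤n , refl) , A₀
      met 1F = p k , inj₁ (k , ≤-refl , z≤n , refl) , A₁
      met 2F = q 0 , inj₂ (0 , z≤n , z≤n , refl) , A₂
    first : ∃ λ s → q m ~ p s × (∀ x → x < s → ¬ q m ~ p x)
    first = least (λ x → q m ~? p x) (proj₁ touches) (proj₂ (proj₂ touches))
    last : ∃ λ s → s ≤ k × q m ~ p s × (∀ x → s < x → x ≤ k → ¬ q m ~ p x)
    last = greatest≤ (λ x → q m ~? p x) k touches
    s₁ s₂ : ℕ
    s₁ = proj₁ first
    s₂ = proj₁ last
    between : ∀ x → x ≤ k → q m ~ p x → s₁ ≤ x × x ≤ s₂
    between x x≤k a = ≮⇒≥ (λ x<s₁ → proj₂ (proj₂ first) x x<s₁ a) ,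
                      ≮⇒≥ (λ s₂<x → proj₂ (proj₂ (proj₂ last)) x s₂<x x≤k a)

  configuration : ∀ {k p} → InducedPath k p → (∀ x → x ≤ k → p x ∈ X) → A 0F (p 0) → A 1F (p k) →
            ¬ ∃≤ (λ x → A 2F (p x)) k → Configuration
  configuration {k} {p} P p∈X A₀ A₁ unmet with meets 2F
  ... | (c , c∈X , A₂c) with firstHit (Near k p) (near? k p) (connected c∈X (p∈X 0 z≤n)) (0 , z≤n , inj₁ refl)
  ...   | (c′ , near-c′ , walk) with walk⇒inducedPath walk
  ...     | (m , q , Q , q₀≡c , qₘ≡c′ , q-ok) =
    configure P p∈X A₀ A₁ unmet near-c′ Q (subst (A 2F) (≡.sym q₀≡c) A₂c) qₘ≡c′ q-ok

  three-terminals : Shape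
  three-terminals with induced-between 0F 1F
  ... | (k , p , P , p∈X , A₀ , A₁) with ∃≤? (λ x → attaches? 2F (p x)) k
  ...   | no unmet = Configured.shape (configuration P p∈X A₀ A₁ unmet)
  ...   | yes (x , x≤k , A₂) = along⇒shape P (segment-fills P p∈X met)
    where
    met : ∀ t → OnSegment p 0 k ≬ A t
    met 0F = p 0 , (0 , z≤n , z≤n , refl) , A₀
    met 1F = p k , (k , ≤-refl , z≤n , refl) , A₁
    met 2F = p x , (x , x≤k , z≤n , refl) , A₂

-- Bag-minimal models

module Bag (G H : Graph) (X : V H → VSet G) (BM : BagMinimal G H X) (y : V H) where
  open Walks G
  open IsModel (proj₁ BM)

  AttachesTo : V H → V G → Set
  AttachesTo z v = ∃ λ w → w ∈ X z × Adj G v w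

  attachesTo? : ∀ z → Decidable (AttachesTo z)
  attachesTo? z v = FinP.any? (λ w → (w SubsetP.∈? X z) ×-dec (v ~? w))

  replaced : VSet G → V H → VSet G
  replaced Y y′ with y′ Fin.≟ y
  ... | yes _ = Y
  ... | no _ = X y′

  replaced-here : ∀ Y → replaced Y y ≡ Y
  replaced-here Y with y Fin.≟ y
  ... | yes _ = refl
  ... | no y≢y = ⊥-elim (y≢y refl)

  bag-minimal : ∀ {Y} → Decidable Y → Y ⊆ (_∈ X y) → Connectedᵖ Y → ∃ Y → (∀ z → Adj H y z → Y ≬ AttachesTo z) →
                (_∈ X y) ⊆ Y
  bag-minimal {Y} Y? Y⊆Xy connected-Y (v₀ , Yv₀) met {v} v∈Xy with Y? v
  ... | yes Yv = Yv
  ... | no ¬Yv = ⊥-elim (proj₂ BM X′ model′ X′⊆X smaller)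
    where
    Y′ : VSet G
    Y′ = toSubset Y?
    X′ : V H → VSet G
    X′ = replaced Y′
    X′⊆X : ∀ y′ → X′ y′ ⊆ₛ X y′
    X′⊆X y′ u∈ with y′ Fin.≟ y
    ... | yes refl = Y⊆Xy (∈-toSubset⁻ Y? u∈)
    ... | no _ = u∈
    nonempty′ : ∀ y′ → Nonempty (X′ y′)
    nonempty′ y′ with y′ Fin.≟ y
    ... | yes refl = v₀ , ∈-toSubset⁺ Y? Yv₀
    ... | no _ = nonempty y′
    connected′ : ∀ y′ → Connected G (X′ y′)
    connected′ y′ with y′ Fin.≟ y
    ... | yes refl = λ u w u∈ w∈ →
      WalkIn⇒Walk (WalkIn-mono (∈-toSubset⁺ Y?) (connected-Y (∈-toSubset⁻ Y? u∈) (∈-toSubset⁻ Y? w∈)))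
    ... | no _ = connected y′
    adjacency′ : ∀ y₁ y₂ → y₁ ≢ y₂ → (AdjacentSets G (X′ y₁) (X′ y₂) ⇔ Adj H y₁ y₂)
    adjacency′ y₁ y₂ y₁≢y₂ =
      mk⇔ (λ (u , w , u∈ , w∈ , u~w) →
             Equivalence.to (adjacency y₁ y₂ y₁≢y₂) (u , w , X′⊆X y₁ u∈ , X′⊆X y₂ w∈ , u~w))
          adjacent
      where
      adjacent : Adj H y₁ y₂ → AdjacentSets G (X′ y₁) (X′ y₂)
      adjacent a with y₁ Fin.≟ y | y₂ Fin.≟ y
      ... | yes refl | yes refl = ⊥-elim (y₁≢y₂ refl)
      ... | yes refl | no _ = let (u , Yu , w , w∈ , u~w) = met y₂ a in u , w , ∈-toSubset⁺ Y? Yu , w∈ , u~w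
      ... | no _ | yes refl = let (u , Yu , w , w∈ , u~w) = met y₁ (trans (Graph.sym H y y₁) a)
                              in w , u , w∈ , ∈-toSubset⁺ Y? Yu , ~-sym u~w
      ... | no _ | no _ = Equivalence.from (adjacency y₁ y₂ y₁≢y₂) a
    model′ : IsModel G H X′
    model′ = record
      { nonempty = nonempty′
      ; disjoint = λ y₁ y₂ y₁≢y₂ u u∈₁ u∈₂ → disjoint y₁ y₂ y₁≢y₂ u (X′⊆X y₁ u∈₁) (X′⊆X y₂ u∈₂)
      ; connected = connected′
      ; adjacency = adjacency′
      }
    smaller : suc (totalSize G H X′) ≤ totalSize G H X
    smaller = sum-map-< (λ y′ → ∣ X′ y′ ∣) (λ y′ → ∣ X y′ ∣) (λ y′ → SubsetP.p⊆q⇒∣p∣≤∣q∣ (X′⊆X y′))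
                (ListMembershipP.∈-allFin y)
                (subst (λ S → ∣ S ∣ < ∣ X y ∣) (≡.sym (replaced-here Y′))
                  (SubsetP.p⊂q⇒∣p∣<∣q∣ (Y⊆Xy ∘ ∈-toSubset⁻ Y? , v , v∈Xy , ¬Yv ∘ ∈-toSubset⁻ Y?)))

  connector : ∀ {d} (z : Fin (suc d) → V H) → (∀ w → Adj H y w → ∃ λ t → z t ≡ w) → (∀ t → Adj H y (z t)) →
              MinimalConnector G (X y) (AttachesTo ∘ z)
  connector z onto y~z = record
    { attaches? = attachesTo? ∘ z
    ; connected = Connected⇒Connectedᵖ (connected y)
    ; meets = meets
    ; minimal = λ {Y} Y? Y⊆Xy connected-Y met →
        bag-minimal Y? Y⊆Xy connected-Y (proj₁ (met Fin.zero) , proj₁ (proj₂ (met Fin.zero)))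
          (λ w a → let (t , zt≡w) = onto w a in subst (λ w → Y ≬ AttachesTo w) zt≡w (met t))
    }
    where
    meets : ∀ t → (_∈ X y) ≬ AttachesTo (z t)
    meets t with Equivalence.from (adjacency y (z t) λ { refl → Walks.~-irrefl H (y~z t) }) (y~z t)
    ... | (u , w , u∈ , w∈ , u~w) = u , u∈ , w , w∈ , u~w

  one-neighbour : (z : V H) → (∀ w → (Adj H y w ⇔ w ≡ z)) → ∣ X y ∣ ≡ 1
  one-neighbour z iff = Connector.one-terminal (connector (λ _ → z) onto (λ _ → Equivalence.from (iff z) refl)) 0F
                          λ { 0F → refl }
    where
    onto : ∀ w → Adj H y w → ∃ λ (_ : Fin 1) → z ≡ w
    onto w a = 0F , ≡.sym (Equivalence.to (iff w) a)

  -- The distinctness of the neighbours, here and in the third case, is never used: attachment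
  -- sets are tracked by the index of the neighbour.
  two-neighbours : (z₁ z₂ : V H) → z₁ ≢ z₂ → (∀ w → (Adj H y w ⇔ (w ≡ z₁ ⊎ w ≡ z₂))) →
                   PathBetweenAttachments G H X y z₁ z₂
  two-neighbours z₁ z₂ _ iff = Connector.two-terminals (connector z onto y~z) 0F 1F cover
    where
    z : Fin 2 → V H
    z 0F = z₁
    z 1F = z₂
    onto : ∀ w → Adj H y w → ∃ λ t → z t ≡ w
    onto w a with Equivalence.to (iff w) a
    ... | inj₁ w≡z₁ = 0F , ≡.sym w≡z₁
    ... | inj₂ w≡z₂ = 1F , ≡.sym w≡z₂
    y~z : ∀ t → Adj H y (z t)
    y~z 0F = Equivalence.from (iff z₁) (inj₁ refl)
    y~z 1F = Equivalence.from (iff z₂) (inj₂ refl)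
    cover : ∀ t → t ≡ 0F ⊎ t ≡ 1F
    cover 0F = inj₁ refl
    cover 1F = inj₂ refl

  module Three (z : Fin 3 → V H) (iff : ∀ w → (Adj H y w ⇔ (∃[ i ] (z i ≡ w)))) where
    C : MinimalConnector G (X y) (AttachesTo ∘ z)
    C = connector z (λ w → Equivalence.to (iff w)) (λ t → Equivalence.from (iff (z t)) (t , refl))
    open Connector C
    open ThreeTerminals C public

    sole⇒∣N∩X∣≤1 : ∀ {j a} → SoleAttachment j a → ∣ N G (X (z j)) ∩ X y ∣ ≤ 1
    sole⇒∣N∩X∣≤1 {j} {a} sole = subst (∣ N G (X (z j)) ∩ X y ∣ ≤_) (SubsetP.∣⁅x⁆∣≡1 a) (SubsetP.p⊆q⇒∣p∣≤∣q∣ ⊆⁅a⁆)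
      where
      ⊆⁅a⁆ : N G (X (z j)) ∩ X y ⊆ₛ ⁅ a ⁆
      ⊆⁅a⁆ u∈ with SubsetP.x∈p∩q⁻ (N G (X (z j))) (X y) u∈
      ... | (u∈N , u∈X) with ∈N⁻ {G} u∈N
      ...   | (w , w∈ , w~u) = subst (_∈ ⁅ a ⁆) (≡.sym (proj₂ sole _ (u∈X , w , w∈ , ~-sym w~u))) (SubsetP.x∈⁅x⁆ a)

    crowded⇒path : ∀ j → 2 ≤ ∣ N G (X (z j)) ∩ X y ∣ → ∀ h i → h ≢ i → h ≢ j → i ≢ j → PathBetween h i
    crowded⇒path j 2≤ h i h≢i h≢j i≢j with three-terminals
    ... | inj₂ (inj₁ ∣X∣≡1) =
      ⊥-elim (≤⇒≯ (subst (∣ N G (X (z j)) ∩ X y ∣ ≤_) ∣X∣≡1 (SubsetP.∣p∩q∣≤∣q∣ (N G (X (z j))) (X y))) 2≤)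
    ... | inj₂ (inj₂ (_ , sole , _)) = ⊥-elim (≤⇒≯ (sole⇒∣N∩X∣≤1 (sole j)) 2≤)
    ... | inj₁ (h′ , i′ , h′≢i′ , a , b , sole-a , sole-b , path) with h′ Fin.≟ j | i′ Fin.≟ j
    ...   | yes refl | _ = ⊥-elim (≤⇒≯ (sole⇒∣N∩X∣≤1 sole-a) 2≤)
    ...   | no _ | yes refl = ⊥-elim (≤⇒≯ (sole⇒∣N∩X∣≤1 sole-b) 2≤)
    ...   | no h′≢j | no i′≢j with Fin3-other-two h≢i h≢j i≢j h′≢i′ h′≢j i′≢j
    ...     | inj₁ (refl , refl) = a , b , sole-a , sole-b , path
    ...     | inj₂ (refl , refl) = b , a , sole-b , sole-a , IsPath-reverse {G} path

lemma5 : (G H : Graph) (X : V H → VSet G) → BagMinimal G H X → (y : V H) →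
    ((z : V H) → (∀ w → (Adj H y w ⇔ w ≡ z)) → ∣ X y ∣ ≡ 1) ×
    ((z₁ z₂ : V H) → z₁ ≢ z₂ → (∀ w → (Adj H y w ⇔ (w ≡ z₁ ⊎ w ≡ z₂))) →
      PathBetweenAttachments G H X y z₁ z₂) ×
    ((z : Fin 3 → V H) → Injective _≡_ _≡_ z → (∀ w → (Adj H y w ⇔ (∃[ i ] (z i ≡ w)))) →
      (((∃[ h ] ∃[ i ] (h ≢ i × PathBetweenAttachments G H X y (z h) (z i)))
        ⊎ ∣ X y ∣ ≡ 1
        ⊎ ∃[ e ] ((∀ i → UniqueAttachment G H X y (z i) (e i)) ×
                   (IsTripod G (X y) e ⊎ IsTriangleTripod G (X y) e)))
      × (∀ j → 2 ≤ ∣ N G (X (z j)) ∩ X y ∣ →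
           ∀ h i → h ≢ i → h ≢ j → i ≢ j →
             PathBetweenAttachments G H X y (z h) (z i))))
lemma5 G H X BM y =
  one-neighbour , two-neighbours , λ z _ iff → let open Three z iff in three-terminals , crowded⇒path
  where open Bag G H X BM y
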